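{- Let $G$ be a $3$-connected $\{K_{1,4},K_{1,4}+e\}$-free split graph with a split partition $(S,I)$ and $|V(G)|\ge 13$, and let $\mathcal P=\{P_i: i\in[h]\}$ be an $I$-cover of $G$. Then: (i) either $S\not\subseteq \bigcup_{i=1}^h V(P_i)$ or $h\ge 2$; and (ii) for any $i\in[h]$, if $u$ and $v$ are the two endpoints of $P_i$, then $G$ has a Hamiltonian $(u,v)$-path, i.e., a path with endpoints $u$ and $v$ containing every vertex of $G$.
   Context: All graphs are finite, simple and connected. A connected graph $G$ is a split graph if its vertex set can be partitioned into a clique and an independent set. A split partition of a split graph $G$ is an ordered pair $(S,I)$ with $V(G)=S\cup I$, $S\cap I=\emptyset$, where $S$ is a maximum clique of $G$ and $I$ is an independent set of $G$. A graph is $\{F_1,\dots,F_k\}$-free if it contains no induced subgraph isomorphic to any $F_i$; $K_{1,4}$ is the star with four leaves and $K_{1,4}+e$ is obtained from $K_{1,4}$ by adding an edge joining two leaves. An $(S,I)$-alternating path is a path $P=a_1a_2\ldots a_{2t+1}$ in $G$ with $a_1\neq a_{2t+1}$ and $V(P)\cap S=\{a_1,a_3,\ldots,a_{2t+1}\}$; its endpoints are $a_1,a_{2t+1}$ and its interior $P^{o}$ is $V(P)\setminus\{a_1,a_{2t+1}\}$. An $I$-cover is a collection $\{P_1,\ldots,P_h\}$ of $(S,I)$-alternating paths that are pairwise vertex-disjoint and satisfy $I\subseteq \bigcup_{i=1}^h P_i^{o}$. $[h]=\{1,\ldots,h\}$. -}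

module Defs where

open import Data.Nat using (ℕ; zero; suc; _+_; _*_; _≤_; _<_; _%_)
open import Data.Fin using (Fin; zero; suc; toℕ; fromℕ; inject₁)
open import Data.Fin.Subset using (Subset; _∈_; _∉_; ∁; ∣_∣)
open import Data.Bool using (Bool; true; false; T)
open import Data.Product using (Σ; ∃; ∃-syntax; _×_; _,_)
open import Relation.Nullary using (¬_)
open import Relation.Binary.PropositionalEquality using (_≡_; _≢_)
open import Function.Definitions using (Injective)
open import Function.Bundles using (_⇔_)

record Graph (n : ℕ) : Set where
  field
    adj    : Fin n → Fin n → Bool
    sym    : ∀ x y → adj x y ≡ adj y x
    irrefl : ∀ x → adj x x ≡ false

open Graph public

Adj : ∀ {n} → Graph n → Fin n → Fin n → Set
Adj G x y = T (adj G x y)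

record Path {n : ℕ} (G : Graph n) (m : ℕ) : Set where
  field
    vert   : Fin (suc m) → Fin n
    distinct : Injective _≡_ _≡_ vert
    linked : ∀ (k : Fin m) → Adj G (vert (inject₁ k)) (vert (suc k))

  start : Fin n
  start = vert zero

  end : Fin n
  end = vert (fromℕ m)

  _∈V : Fin n → Set
  x ∈V = ∃[ k ] vert k ≡ x

open Path public

ConnectedOn : ∀ {n} → Graph n → (Fin n → Set) → Set
ConnectedOn {n} G keep =
  ∀ x y → keep x → keep y →
    ∃[ m ] Σ (Path G m) λ P →
      start P ≡ x × end P ≡ y × (∀ k → keep (vert P k))

Connected : ∀ {n} → Graph n → Set
Connected {n} G = 1 ≤ n × ConnectedOn G (λ _ → Data.Unit.⊤)
  where import Data.Unit

KConnected : ℕ → ∀ {n} → Graph n → Set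
KConnected k {n} G =
  k < n × (∀ (X : Subset n) → ∣ X ∣ < k → ConnectedOn G (λ v → v ∉ X))

InducedSub : ∀ {k n} → Graph k → Graph n → Set
InducedSub {k} {n} F G =
  Σ (Fin k → Fin n) λ f → Injective _≡_ _≡_ f × (∀ x y → adj F x y ≡ adj G (f x) (f y))

_-Free : ∀ {k n} → Graph k → Graph n → Set
(F -Free) G = ¬ InducedSub F G

k14adj : Fin 5 → Fin 5 → Bool
k14adj zero zero = false
k14adj zero (suc _) = true
k14adj (suc _) zero = true
k14adj (suc _) (suc _) = false

K14 : Graph 5
K14 = record { adj = k14adj ; sym = s ; irrefl = i }
  where
    s : ∀ x y → k14adj x y ≡ k14adj y x
    s zero zero = _≡_.refl
    s zero (suc y) = _≡_.refl
    s (suc x) zero = _≡_.refl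
    s (suc x) (suc y) = _≡_.refl
    i : ∀ x → k14adj x x ≡ false
    i zero = _≡_.refl
    i (suc x) = _≡_.refl

-- K_{1,4}+e: K_{1,4} plus the edge between leaves 1 and 2
-- (leaves are suc l for l : Fin 4; the extra edge joins l = 0 and l = 1)
leafEdge : Fin 4 → Fin 4 → Bool
leafEdge zero (suc zero) = true
leafEdge (suc zero) zero = true
leafEdge _ _ = false

k14eadj : Fin 5 → Fin 5 → Bool
k14eadj zero zero = false
k14eadj zero (suc _) = true
k14eadj (suc _) zero = true
k14eadj (suc x) (suc y) = leafEdge x y

K14e : Graph 5
K14e = record { adj = k14eadj ; sym = s ; irrefl = i }
  where
    le : ∀ x y → leafEdge x y ≡ leafEdge y x
    le zero zero = _≡_.refl
    le zero (suc zero) = _≡_.refl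
    le zero (suc (suc zero)) = _≡_.refl
    le zero (suc (suc (suc zero))) = _≡_.refl
    le (suc zero) zero = _≡_.refl
    le (suc zero) (suc zero) = _≡_.refl
    le (suc zero) (suc (suc zero)) = _≡_.refl
    le (suc zero) (suc (suc (suc zero))) = _≡_.refl
    le (suc (suc zero)) zero = _≡_.refl
    le (suc (suc zero)) (suc zero) = _≡_.refl
    le (suc (suc zero)) (suc (suc zero)) = _≡_.refl
    le (suc (suc zero)) (suc (suc (suc zero))) = _≡_.refl
    le (suc (suc (suc zero))) zero = _≡_.refl
    le (suc (suc (suc zero))) (suc zero) = _≡_.refl
    le (suc (suc (suc zero))) (suc (suc zero)) = _≡_.refl
    le (suc (suc (suc zero))) (suc (suc (suc zero))) = _≡_.refl
    s : ∀ x y → k14eadj x y ≡ k14eadj y x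
    s zero zero = _≡_.refl
    s zero (suc y) = _≡_.refl
    s (suc x) zero = _≡_.refl
    s (suc x) (suc y) = le x y
    i : ∀ x → k14eadj x x ≡ false
    i zero = _≡_.refl
    i (suc zero) = _≡_.refl
    i (suc (suc zero)) = _≡_.refl
    i (suc (suc (suc zero))) = _≡_.refl
    i (suc (suc (suc (suc zero)))) = _≡_.refl

IsClique : ∀ {n} → Graph n → Subset n → Set
IsClique G C = ∀ x y → x ∈ C → y ∈ C → x ≢ y → Adj G x y

IsIndependent : ∀ {n} → Graph n → Subset n → Set
IsIndependent G J = ∀ x y → x ∈ J → y ∈ J → ¬ Adj G x y

IsSplitPartition : ∀ {n} → Graph n → Subset n → Set
IsSplitPartition {n} G S =
  IsClique G S × (∀ C → IsClique G C → ∣ C ∣ ≤ ∣ S ∣) × IsIndependent G (∁ S)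

-- An (S,I)-alternating path a_1 … a_{2t+1} (indices 0 … 2t here):
-- a_1 ≠ a_{2t+1}, and a_k ∈ S iff its (0-based) index is even.
record AltPath {n : ℕ} (G : Graph n) (S : Subset n) : Set where
  field
    t     : ℕ
    path  : Path G (2 * t)
    ends≢ : start path ≢ end path
    alt   : ∀ k → (vert path k ∈ S) ⇔ (toℕ k % 2 ≡ 0)

open AltPath public

InInterior : ∀ {n} {G : Graph n} {S : Subset n} → AltPath G S → Fin n → Set
InInterior P x = (path P ∈V) x × x ≢ start (path P) × x ≢ end (path P)

IsICover : ∀ {n} (G : Graph n) (S : Subset n) (h : ℕ) → (Fin h → AltPath G S) → Set
IsICover {n} G S h P =
  (∀ i j → i ≢ j → ∀ x → (path (P i) ∈V) x → ¬ (path (P j) ∈V) x) ×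
  (∀ x → x ∈ ∁ S → ∃[ i ] InInterior (P i) x)

HamPath : ∀ {n} → Graph n → Fin n → Fin n → Set
HamPath {n} G u v =
  ∃[ m ] Σ (Path G m) λ P → start P ≡ u × end P ≡ v × (∀ x → (P ∈V) x)

{-# OPTIONS --safe #-}
-- Every vertex of I lies inside a cover path and, G being 3-connected, has at least three
-- neighbours, all in the clique S.  Call a path Q saturated if all neighbours of its I-vertices
-- lie on Q.  If moreover no vertex of S has three neighbours in I on Q (a claw), then the third
-- neighbour of every I-vertex of Q is an end of Q, and this forces Q to have length 4.
--
-- (ii) Let Q be a cover path missing some vertex.  If Q is not saturated, an I-vertex x of Q
-- has a neighbour w ∈ S off Q; reroute Q just before x through the cover path of w (or w
-- alone), traversed so that it ends at w.  When w is an inner vertex of its path, its two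
-- neighbours there form a claw with x, and the forbidden stars make the predecessor of x
-- adjacent to one of them.  The new path has an edge inside S, where each remaining cover path
-- and each remaining vertex of S can be spliced in, one after the other.  If Q is saturated, a
-- vertex of S off Q is adjacent to two leaves of any claw, so Q carries no claw and has length
-- 4; then its first vertex and two vertices of S off Q induce a K₁,₄ + e.
--
-- (i) If h ≤ 1 and the cover meets all of S, its path passes through all n ≥ 13 vertices, so
-- it is saturated.  Counting the S-neighbours of its I-vertices around a claw bounds its length
-- by 10, so it carries no claw, and then it has length 4.

module Submission where

open import Defs hiding (sym)
open import Data.Bool using (Bool; true; false; not; T; T?)
open import Data.Bool.Properties using (T-≡)
open import Data.Empty using (⊥; ⊥-elim)
open import Data.Fin as Fin using (Fin; zero; suc; toℕ; fromℕ; inject₁)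
import Data.Fin.Properties as Finₚ
open import Data.Fin.Subset using (Subset; _∈_; _∉_; ∁; ∣_∣; inside; outside)
open import Data.Fin.Subset.Properties using (_∈?_; ∣∁p∣≡n∸∣p∣; x∉p⇒x∈∁p; x∈∁p⇒x∉p)
open import Data.List using (List; []; _∷_; _++_)
open import Data.List.Properties using (++-identityʳ)
open import Data.List.Membership.Propositional using () renaming (_∈_ to _∈ˡ_; _∉_ to _∉ˡ_)
open import Data.List.Membership.Propositional.Properties using (∈-++⁺ˡ; ∈-++⁺ʳ; ∈-++⁻)
open import Data.List.Relation.Unary.Any using (here; there)
open import Data.List.Relation.Unary.Unique.Propositional using (Unique)
open import Data.List.Relation.Binary.Disjoint.Propositional using (Disjoint)
import Data.List.Relation.Unary.Unique.Propositional.Properties as Uniqueₚ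
open import Data.List.Relation.Unary.AllPairs using ([]; _∷_)
open import Data.List.Relation.Unary.All as ListAll using ([]; _∷_)
open import Data.Nat as ℕ using (ℕ; zero; suc; _+_; _*_; _∸_; _≤_; _<_; _≤‴_; z≤n; s≤s; _%_; ⌊_/2⌋)
import Data.Nat.Properties as ℕₚ
open import Data.Product using (Σ; ∃; ∃-syntax; _×_; _,_; proj₁; proj₂)
open import Data.Sum using (_⊎_; inj₁; inj₂)
import Data.Sum.Properties
open import Data.Vec as Vec using (Vec; []; _∷_; here; there)
import Data.Vec.Properties as Vecₚ
import Data.Vec.Relation.Unary.All as VecAll
open import Data.Vec.Relation.Unary.All using ([]; _∷_)
open import Data.Vec.Relation.Unary.AllPairs using ([]; _∷_)
open import Data.Vec.Relation.Unary.All.Properties using (lookup⁺)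
import Data.Vec.Relation.Unary.Unique.Propositional as VecUnique
import Data.Vec.Relation.Unary.Unique.Propositional.Properties as VecUniqueₚ
open import Function using (id; _∘_; _⇔_; _↔_; Inverse; Injection; Injective; mk⇔; Equivalence)
open import Function.Properties.Inverse using (↔-sym; ↔⇒↣)
open import Relation.Nullary using (¬_; ¬?; Dec; yes; no)
open import Relation.Nullary.Decidable using (_×-dec_; decidable-stable)
open import Relation.Binary.PropositionalEquality
  using (_≡_; _≢_; refl; sym; trans; cong; subst; subst₂)

even : ℕ → Bool
even zero = true
even (suc zero) = false
even (suc (suc i)) = even i

even-suc : ∀ i → even (suc i) ≡ not (even i)
even-suc zero = refl
even-suc (suc zero) = refl
even-suc (suc (suc i)) = even-suc i

even-2* : ∀ t → even (2 * t) ≡ true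
even-2* zero = refl
even-2* (suc t) rewrite ℕₚ.*-suc 2 t = even-2* t

even⇔%2≡0 : ∀ i → even i ≡ true ⇔ i % 2 ≡ 0
even⇔%2≡0 zero = mk⇔ (λ _ → refl) (λ _ → refl)
even⇔%2≡0 (suc zero) = mk⇔ (λ ()) (λ ())
even⇔%2≡0 (suc (suc i)) = even⇔%2≡0 i

even-∸ : ∀ {m} k → even m ≡ true → k ≤ m → even (m ∸ k) ≡ even k
even-∸ zero m-even _ = m-even
even-∸ {suc (suc m)} (suc zero) m-even _ = trans (even-suc m) (cong not m-even)
even-∸ {suc (suc m)} (suc (suc k)) m-even (s≤s (s≤s k≤m)) = even-∸ k m-even k≤m

∸-suc-∸ : ∀ {m k} → suc k ≤ m → m ∸ suc (m ∸ suc k) ≡ k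
∸-suc-∸ {m} {k} sk≤m =
  trans (sym (ℕₚ.pred[m∸n]≡m∸[1+n] m (m ∸ suc k))) (cong ℕ.pred (ℕₚ.m∸[m∸n]≡n sk≤m))

0<even⇒2≤ : ∀ {m} → 0 < m → even m ≡ true → 2 ≤ m
0<even⇒2≤ {suc (suc m)} _ _ = s≤s (s≤s z≤n)

even-2<m<6⇒m≡4 : ∀ {m} → even m ≡ true → 2 < m → m < 6 → m ≡ 4
even-2<m<6⇒m≡4 {2} _ (s≤s (s≤s ())) _
even-2<m<6⇒m≡4 {4} _ _ _ = refl
even-2<m<6⇒m≡4 {suc (suc (suc (suc (suc (suc _)))))} _ _ (s≤s (s≤s (s≤s (s≤s (s≤s (s≤s ()))))))

⌊/2⌋-injective : ∀ {a b} → even a ≡ true → even b ≡ true → ⌊ a /2⌋ ≡ ⌊ b /2⌋ → a ≡ b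
⌊/2⌋-injective {zero} {zero} _ _ _ = refl
⌊/2⌋-injective {zero} {suc (suc b)} _ _ ()
⌊/2⌋-injective {suc (suc a)} {zero} _ _ ()
⌊/2⌋-injective {suc (suc a)} {suc (suc b)} a-even b-even eq =
  cong (λ i → suc (suc i)) (⌊/2⌋-injective a-even b-even (ℕₚ.suc-injective eq))

⌊2*/2⌋ : ∀ t → ⌊ 2 * t /2⌋ ≡ t
⌊2*/2⌋ zero = refl
⌊2*/2⌋ (suc t) rewrite ℕₚ.*-suc 2 t = cong suc (⌊2*/2⌋ t)

injection⇒≤ : ∀ {a b} {A B : Set} → Fin a ↔ A → Fin b ↔ B →
              (f : A → B) → (∀ {x y} → f x ≡ f y → x ≡ y) → a ≤ b
injection⇒≤ A↔ B↔ f f-injective = Finₚ.injective⇒≤ {f = Inverse.from B↔ ∘ f ∘ Inverse.to A↔}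
  (Injection.injective (↔⇒↣ A↔) ∘ f-injective ∘ Injection.injective (↔⇒↣ (↔-sym B↔)))

Fin-irrelevant : ∀ {h} → ¬ 2 ≤ h → (i j : Fin h) → i ≡ j
Fin-irrelevant {suc zero} _ zero zero = refl
Fin-irrelevant {suc (suc h)} h<2 _ _ = ⊥-elim (h<2 (s≤s (s≤s z≤n)))

coding⇒≤ : ∀ {n b} (f : Fin n → ℕ) → (∀ x → f x < b) → (∀ {x y} → f x ≡ f y → x ≡ y) →
           n ≤ b
coding⇒≤ f f<b f-injective = Finₚ.injective⇒≤ {f = λ x → Fin.fromℕ< (f<b x)} λ {x} {y} eq →
  f-injective (trans (sym (Finₚ.toℕ-fromℕ< (f<b x))) (trans (cong toℕ eq) (Finₚ.toℕ-fromℕ< (f<b y))))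

members : ∀ {n k} (p : Subset n) → k ≤ ∣ p ∣ →
          Σ (Fin k → Fin n) λ f → Injective _≡_ _≡_ f × (∀ i → f i ∈ p)
members {k = zero} p _ = (λ ()) , (λ { {()} }) , (λ ())
members (outside ∷ p) k≤∣p∣ with members p k≤∣p∣
... | f , f-inj , f∈p = suc ∘ f , f-inj ∘ Finₚ.suc-injective , there ∘ f∈p
members {k = suc k} (inside ∷ p) (s≤s k≤∣p∣) with members p k≤∣p∣
... | f , f-inj , f∈p = g , g-inj , g∈
  where
  g : Fin (suc k) → Fin _
  g zero = zero
  g (suc i) = suc (f i)
  g-inj : Injective _≡_ _≡_ g
  g-inj {zero} {zero} _ = refl
  g-inj {suc i} {suc j} eq = cong suc (f-inj (Finₚ.suc-injective eq))
  g∈ : ∀ i → g i ∈ inside ∷ p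
  g∈ zero = here
  g∈ (suc i) = there (f∈p i)

avoiding-two : ∀ {n} (f : Fin 3 → Fin n) → Injective _≡_ _≡_ f →
               ∀ a b → ∃ λ i → f i ≢ a × f i ≢ b
avoiding-two f f-inj a b with f zero Finₚ.≟ a | f zero Finₚ.≟ b
... | no f0≢a | no f0≢b = zero , f0≢a , f0≢b
... | yes f0≡a | _ with f (suc zero) Finₚ.≟ b
...   | no f1≢b = suc zero , (λ ()) ∘ f-inj ∘ trans f0≡a ∘ sym , f1≢b
...   | yes f1≡b =
  suc (suc zero) , (λ ()) ∘ f-inj ∘ trans f0≡a ∘ sym , (λ ()) ∘ f-inj ∘ trans f1≡b ∘ sym
avoiding-two f f-inj a b | no _ | yes f0≡b with f (suc zero) Finₚ.≟ a
...   | no f1≢a = suc zero , f1≢a , (λ ()) ∘ f-inj ∘ trans f0≡b ∘ sym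
...   | yes f1≡a =
  suc (suc zero) , (λ ()) ∘ f-inj ∘ trans f1≡a ∘ sym , (λ ()) ∘ f-inj ∘ trans f0≡b ∘ sym

module _ {A : Set} where

  ∈-insert⁻ : ∀ xs ys {zs} {v : A} → v ∈ˡ (xs ++ ys) ++ zs → v ∈ˡ xs ++ zs ⊎ v ∈ˡ ys
  ∈-insert⁻ xs ys v∈ with ∈-++⁻ (xs ++ ys) v∈
  ... | inj₂ v∈zs = inj₁ (∈-++⁺ʳ xs v∈zs)
  ... | inj₁ v∈xsys with ∈-++⁻ xs v∈xsys
  ...   | inj₁ v∈xs = inj₁ (∈-++⁺ˡ v∈xs)
  ...   | inj₂ v∈ys = inj₂ v∈ys

  ∈-insert⁺ˡ : ∀ xs ys {zs} {v : A} → v ∈ˡ xs ++ zs → v ∈ˡ (xs ++ ys) ++ zs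
  ∈-insert⁺ˡ xs ys v∈ with ∈-++⁻ xs v∈
  ... | inj₁ v∈xs = ∈-++⁺ˡ (∈-++⁺ˡ v∈xs)
  ... | inj₂ v∈zs = ∈-++⁺ʳ (xs ++ ys) v∈zs

  ∈-insert⁺ʳ : ∀ xs {ys} zs {v : A} → v ∈ˡ ys → v ∈ˡ (xs ++ ys) ++ zs
  ∈-insert⁺ʳ xs zs v∈ys = ∈-++⁺ˡ (∈-++⁺ʳ xs v∈ys)

  ∈-middle⁻ : ∀ as xs ys bs {v : A} → v ∈ˡ (as ++ xs) ++ (ys ++ bs) →
              v ∈ˡ as ⊎ v ∈ˡ xs ++ ys ⊎ v ∈ˡ bs
  ∈-middle⁻ as xs ys bs v∈ with ∈-++⁻ (as ++ xs) v∈
  ... | inj₁ v∈asxs = Data.Sum.map₂ (inj₁ ∘ ∈-++⁺ˡ) (∈-++⁻ as v∈asxs)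
  ... | inj₂ v∈ysbs = inj₂ (Data.Sum.map₁ (∈-++⁺ʳ xs) (∈-++⁻ ys v∈ysbs))

  ∈-middle⁺ : ∀ as xs ys bs {v : A} → v ∈ˡ as ⊎ v ∈ˡ xs ++ ys ⊎ v ∈ˡ bs →
              v ∈ˡ (as ++ xs) ++ (ys ++ bs)
  ∈-middle⁺ as xs ys bs (inj₁ v∈as) = ∈-++⁺ˡ (∈-++⁺ˡ v∈as)
  ∈-middle⁺ as xs ys bs (inj₂ (inj₂ v∈bs)) = ∈-++⁺ʳ (as ++ xs) (∈-++⁺ʳ ys v∈bs)
  ∈-middle⁺ as xs ys bs (inj₂ (inj₁ v∈xsys)) with ∈-++⁻ xs v∈xsys
  ... | inj₁ v∈xs = ∈-++⁺ˡ (∈-++⁺ʳ as v∈xs)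
  ... | inj₂ v∈ys = ∈-++⁺ʳ (as ++ xs) (∈-++⁺ˡ v∈ys)

module _ {n} (G : Graph n) where

  Adj-sym : ∀ {x y} → Adj G x y → Adj G y x
  Adj-sym {x} {y} = subst T (Graph.sym G x y)

  Adj⇒≢ : ∀ {x y} → Adj G x y → x ≢ y
  Adj⇒≢ {x} x~x refl = subst T (irrefl G x) x~x

  Adj? : ∀ x y → Dec (Adj G x y)
  Adj? x y = T? (adj G x y)

  neighbourhood : Fin n → Subset n
  neighbourhood x = Vec.tabulate (adj G x)

  ∈-neighbourhood : ∀ {x y} → y ∈ neighbourhood x ⇔ Adj G x y
  ∈-neighbourhood {x} {y} = mk⇔
    (λ y∈N → Equivalence.from T-≡ (trans (sym (lookup-N y)) (Vecₚ.[]=⇒lookup y∈N)))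
    (λ x~y → Vecₚ.lookup⇒[]= y _ (trans (lookup-N y) (Equivalence.to T-≡ x~y)))
    where lookup-N = Vecₚ.lookup∘tabulate (adj G x)

  -- If fewer than k vertices contained all neighbours of x, deleting them would isolate x.
  min-degree : ∀ {k} → KConnected k G → ∀ x → k ≤ ∣ neighbourhood x ∣
  min-degree {k} (k<n , connected) x with k ℕ.≤? ∣ neighbourhood x ∣
  ... | yes k≤∣N∣ = k≤∣N∣
  ... | no k≰∣N∣ = ⊥-elim (isolated far)
    where
    N = neighbourhood x
    ∣N∣<k : ∣ N ∣ < k
    ∣N∣<k = ℕₚ.≰⇒> k≰∣N∣
    x∉N : x ∉ N
    x∉N x∈N = Adj⇒≢ (Equivalence.to ∈-neighbourhood x∈N) refl
    two-outside : 2 ≤ ∣ ∁ N ∣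
    two-outside = subst (2 ≤_) (sym (∣∁p∣≡n∸∣p∣ N))
      (ℕₚ.m+n≤o⇒m≤o∸n 2 (ℕₚ.≤-trans (s≤s ∣N∣<k) k<n))
    far : ∃ λ z → z ∉ N × z ≢ x
    far with members (∁ N) two-outside
    ... | f , f-inj , f∈ with f zero Finₚ.≟ x
    ...   | no f0≢x = f zero , x∈∁p⇒x∉p (f∈ zero) , f0≢x
    ...   | yes f0≡x = f (suc zero) , x∈∁p⇒x∉p (f∈ (suc zero)) ,
                       λ f1≡x → Finₚ.0≢1+n (f-inj (trans f0≡x (sym f1≡x)))
    isolated : (∃ λ z → z ∉ N × z ≢ x) → ⊥
    isolated (z , z∉N , z≢x) with connected N ∣N∣<k x z x∉N z∉N
    ... | zero , P , start≡x , end≡z , _ = z≢x (trans (sym end≡z) start≡x)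
    ... | suc m , P , start≡x , _ , avoids =
      avoids (suc zero) (Equivalence.from ∈-neighbourhood
        (subst (λ v → Adj G v (vert P (suc zero))) start≡x (linked P zero)))

  neighbours₃ : KConnected 3 G → ∀ x →
                Σ (Fin 3 → Fin n) λ f → Injective _≡_ _≡_ f × (∀ i → Adj G x (f i))
  neighbours₃ 3-conn x with members (neighbourhood x) (min-degree 3-conn x)
  ... | f , f-inj , f∈N = f , f-inj , Equivalence.to ∈-neighbourhood ∘ f∈N

  neighbour-avoiding : KConnected 3 G → ∀ x a b → ∃ λ y → Adj G x y × y ≢ a × y ≢ b
  neighbour-avoiding 3-conn x a b with neighbours₃ 3-conn x
  ... | f , f-inj , x~f with avoiding-two f f-inj a b
  ...   | i , fi≢a , fi≢b = f i , x~f i , fi≢a , fi≢b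

module Walks {n} (G : Graph n) where

  infixr 5 _∷⟨_⟩_ _++⟨_⟩_

  data Walk : Fin n → Fin n → Set where
    [_]    : ∀ x → Walk x x
    _∷⟨_⟩_ : ∀ x {y z} → Adj G x y → Walk y z → Walk x z

  vertices : ∀ {x y} → Walk x y → List (Fin n)
  vertices [ x ] = x ∷ []
  vertices (x ∷⟨ _ ⟩ w) = x ∷ vertices w

  _++⟨_⟩_ : ∀ {a b c d} → Walk a b → Adj G b c → Walk c d → Walk a d
  [ x ] ++⟨ b~c ⟩ w′ = x ∷⟨ b~c ⟩ w′
  (x ∷⟨ x~y ⟩ w) ++⟨ b~c ⟩ w′ = x ∷⟨ x~y ⟩ (w ++⟨ b~c ⟩ w′)

  vertices-++ : ∀ {a b c d} (w : Walk a b) (b~c : Adj G b c) (w′ : Walk c d) →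
                vertices (w ++⟨ b~c ⟩ w′) ≡ vertices w ++ vertices w′
  vertices-++ [ x ] _ _ = refl
  vertices-++ (x ∷⟨ _ ⟩ w) b~c w′ = cong (x ∷_) (vertices-++ w b~c w′)

  first∈ : ∀ {x y} (w : Walk x y) → x ∈ˡ vertices w
  first∈ [ x ] = here refl
  first∈ (x ∷⟨ _ ⟩ w) = here refl

  last∈ : ∀ {x y} (w : Walk x y) → y ∈ˡ vertices w
  last∈ [ x ] = here refl
  last∈ (x ∷⟨ _ ⟩ w) = there (last∈ w)

  length : ∀ {x y} → Walk x y → ℕ
  length [ x ] = zero
  length (x ∷⟨ _ ⟩ w) = suc (length w)

  vertex : ∀ {x y} (w : Walk x y) → Fin (suc (length w)) → Fin n
  vertex [ x ] _ = x
  vertex (x ∷⟨ _ ⟩ w) zero = x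
  vertex (x ∷⟨ _ ⟩ w) (suc k) = vertex w k

  vertex-first : ∀ {x y} (w : Walk x y) → vertex w zero ≡ x
  vertex-first [ x ] = refl
  vertex-first (x ∷⟨ _ ⟩ w) = refl

  vertex-last : ∀ {x y} (w : Walk x y) → vertex w (fromℕ (length w)) ≡ y
  vertex-last [ x ] = refl
  vertex-last (x ∷⟨ _ ⟩ w) = vertex-last w

  vertex∈ : ∀ {x y} (w : Walk x y) k → vertex w k ∈ˡ vertices w
  vertex∈ [ x ] zero = here refl
  vertex∈ (x ∷⟨ _ ⟩ w) zero = here refl
  vertex∈ (x ∷⟨ _ ⟩ w) (suc k) = there (vertex∈ w k)

  ∈⇒vertex : ∀ {x y z} (w : Walk x y) → z ∈ˡ vertices w → ∃ λ k → vertex w k ≡ z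
  ∈⇒vertex [ x ] (here refl) = zero , refl
  ∈⇒vertex (x ∷⟨ _ ⟩ w) (here refl) = zero , refl
  ∈⇒vertex (x ∷⟨ _ ⟩ w) (there z∈w) with ∈⇒vertex w z∈w
  ... | k , eq = suc k , eq

  vertex-injective : ∀ {x y} (w : Walk x y) → Unique (vertices w) → Injective _≡_ _≡_ (vertex w)
  vertex-injective [ x ] _ {zero} {zero} _ = refl
  vertex-injective (x ∷⟨ _ ⟩ w) _ {zero} {zero} _ = refl
  vertex-injective (x ∷⟨ _ ⟩ w) x∷w-unique {zero} {suc k} eq =
    ⊥-elim (Uniqueₚ.Unique[x∷xs]⇒x∉xs x∷w-unique (subst (_∈ˡ vertices w) (sym eq) (vertex∈ w k)))
  vertex-injective (x ∷⟨ _ ⟩ w) x∷w-unique {suc k} {zero} eq =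
    ⊥-elim (Uniqueₚ.Unique[x∷xs]⇒x∉xs x∷w-unique (subst (_∈ˡ vertices w) eq (vertex∈ w k)))
  vertex-injective (x ∷⟨ _ ⟩ w) (_ ∷ w-unique) {suc j} {suc k} eq =
    cong suc (vertex-injective w w-unique eq)

  length-++ : ∀ {a b c d} (w : Walk a b) (b~c : Adj G b c) (w′ : Walk c d) →
              length (w ++⟨ b~c ⟩ w′) ≡ suc (length w + length w′)
  length-++ [ x ] _ _ = refl
  length-++ (x ∷⟨ _ ⟩ w) b~c w′ = cong suc (length-++ w b~c w′)

  length<-outside : ∀ {x y z} (w : Walk x y) → Unique (vertices w) → z ∉ˡ vertices w →
                    suc (length w) < n
  length<-outside {z = z} w w-unique z∉w = Finₚ.injective⇒≤ {f = f} f-injective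
    where
    f : Fin (suc (suc (length w))) → Fin n
    f zero = z
    f (suc k) = vertex w k
    f-injective : Injective _≡_ _≡_ f
    f-injective {zero} {zero} _ = refl
    f-injective {zero} {suc k} eq = ⊥-elim (z∉w (subst (_∈ˡ vertices w) (sym eq) (vertex∈ w k)))
    f-injective {suc k} {zero} eq = ⊥-elim (z∉w (subst (_∈ˡ vertices w) eq (vertex∈ w k)))
    f-injective {suc j} {suc k} eq = cong suc (vertex-injective w w-unique eq)

  vertex-linked : ∀ {x y} (w : Walk x y) (k : Fin (length w)) →
                  Adj G (vertex w (inject₁ k)) (vertex w (suc k))
  vertex-linked (x ∷⟨ x~y ⟩ w) zero = subst (Adj G x) (sym (vertex-first w)) x~y
  vertex-linked (x ∷⟨ _ ⟩ w) (suc k) = vertex-linked w k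

  hamiltonian : ∀ {u v} (w : Walk u v) → Unique (vertices w) → (∀ x → x ∈ˡ vertices w) →
                HamPath G u v
  hamiltonian w w-unique spanning =
    length w ,
    record { vert = vertex w ; distinct = vertex-injective w w-unique ; linked = vertex-linked w } ,
    vertex-first w , vertex-last w , λ x → ∈⇒vertex w (spanning x)

clamp : ∀ m → ℕ → Fin (suc m)
clamp m zero = zero
clamp zero (suc i) = zero
clamp (suc m) (suc i) = suc (clamp m i)

toℕ-clamp : ∀ {m i} → i ≤ m → toℕ (clamp m i) ≡ i
toℕ-clamp {m} {zero} _ = refl
toℕ-clamp {suc m} {suc i} (s≤s i≤m) = cong suc (toℕ-clamp i≤m)

clamp-toℕ : ∀ {m} (k : Fin (suc m)) → clamp m (toℕ k) ≡ k
clamp-toℕ zero = refl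
clamp-toℕ {suc m} (suc k) = cong suc (clamp-toℕ k)

inject₁-clamp : ∀ {m i} → i ≤ m → inject₁ (clamp m i) ≡ clamp (suc m) i
inject₁-clamp {m} {zero} _ = refl
inject₁-clamp {suc m} {suc i} (s≤s i≤m) = cong suc (inject₁-clamp i≤m)

module Tracks {n} (G : Graph n) (S : Subset n) where

  open Walks G

  -- The path at 0, at 1, …, at len; `at` is junk beyond len.
  record Track : Set where
    field
      len          : ℕ
      at           : ℕ → Fin n
      linked       : ∀ {i} → i < len → Adj G (at i) (at (suc i))
      at-injective : ∀ {i j} → i ≤ len → j ≤ len → at i ≡ at j → i ≡ j
      parity       : ∀ {i} → i ≤ len → at i ∈ S ⇔ even i ≡ true
      len-even     : even len ≡ true
      len>0        : 0 < len

  open Track public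

  infix 4 _∈ₜ_
  _∈ₜ_ : Fin n → Track → Set
  x ∈ₜ T = ∃ λ i → i ≤ len T × at T i ≡ x

  _∈ₜ?_ : ∀ x T → Dec (x ∈ₜ T)
  x ∈ₜ? T with Finₚ.any? (λ (k : Fin (suc (len T))) → at T (toℕ k) Finₚ.≟ x)
  ... | yes (k , eq) = yes (toℕ k , ℕₚ.≤-pred (Finₚ.toℕ<n k) , eq)
  ... | no none = no λ (i , i≤len , eq) →
    none (Fin.fromℕ< (s≤s i≤len) ,
          subst (λ j → at T j ≡ x) (sym (Finₚ.toℕ-fromℕ< (s≤s i≤len))) eq)

  module _ (T : Track) where

    at∈ₜ : ∀ {i} → i ≤ len T → at T i ∈ₜ T
    at∈ₜ i≤len = _ , i≤len , refl

    even⇒∈S : ∀ {i} → i ≤ len T → even i ≡ true → at T i ∈ S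
    even⇒∈S i≤len = Equivalence.from (parity T i≤len)

    odd⇒∉S : ∀ {i} → i ≤ len T → even i ≡ false → at T i ∉ S
    odd⇒∉S i≤len i-odd at∈S with trans (sym i-odd) (Equivalence.to (parity T i≤len) at∈S)
    ... | ()

    ∈S⇒even : ∀ {i} → i ≤ len T → at T i ∈ S → even i ≡ true
    ∈S⇒even i≤len = Equivalence.to (parity T i≤len)

    start∈S : at T 0 ∈ S
    start∈S = even⇒∈S z≤n refl

    end∈S : at T (len T) ∈ S
    end∈S = even⇒∈S ℕₚ.≤-refl (len-even T)

    next∉S : ∀ {i} → i < len T → at T i ∈ S → at T (suc i) ∉ S
    next∉S {i} i<len at-i∈S =
      odd⇒∉S i<len (trans (even-suc i) (cong not (∈S⇒even (ℕₚ.<⇒≤ i<len) at-i∈S)))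

    previous∉S : ∀ {i} → i < len T → at T (suc i) ∈ S → at T i ∉ S
    previous∉S {i} i<len at-suc-i∈S at-i∈S
      with trans (sym (∈S⇒even i<len at-suc-i∈S))
                 (trans (even-suc i) (cong not (∈S⇒even (ℕₚ.<⇒≤ i<len) at-i∈S)))
    ... | ()

    start≢end : at T 0 ≢ at T (len T)
    start≢end eq = ℕₚ.<⇒≢ (len>0 T) (at-injective T z≤n ℕₚ.≤-refl eq)

    n≤len+2 : ∀ {w} → (∀ {x} → ¬ x ∈ₜ T → x ≡ w) → n ≤ suc (suc (len T))
    n≤len+2 {w} off⇒w =
      coding⇒≤ (λ x → index (x ∈ₜ? T)) (λ x → index<len+2 (x ∈ₜ? T))
        λ {x} {y} → index-injective (x ∈ₜ? T) (y ∈ₜ? T)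
      where
      index : ∀ {x} → Dec (x ∈ₜ T) → ℕ
      index (yes (i , _)) = i
      index (no _) = suc (len T)
      index<len+2 : ∀ {x} (d : Dec (x ∈ₜ T)) → index d < suc (suc (len T))
      index<len+2 (yes (_ , i≤len , _)) = s≤s (ℕₚ.m≤n⇒m≤1+n i≤len)
      index<len+2 (no _) = ℕₚ.≤-refl
      index-injective : ∀ {x y} (d : Dec (x ∈ₜ T)) (d′ : Dec (y ∈ₜ T)) →
                        index d ≡ index d′ → x ≡ y
      index-injective (yes (i , _ , refl)) (yes (i , _ , refl)) refl = refl
      index-injective (yes (_ , i≤len , _)) (no _) refl = ⊥-elim (ℕₚ.<-irrefl refl (s≤s i≤len))
      index-injective (no _) (yes (_ , i≤len , _)) refl = ⊥-elim (ℕₚ.<-irrefl refl (s≤s i≤len))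
      index-injective (no x∉T) (no y∉T) _ = trans (off⇒w x∉T) (sym (off⇒w y∉T))

    private
      segment‴ : ∀ {i j} → i ≤‴ j → j ≤ len T → Walk (at T i) (at T j)
      segment‴ {i} ℕ.≤‴-refl _ = [ at T i ]
      segment‴ {i} (ℕ.≤‴-step i<j) j≤len =
        at T i ∷⟨ linked T (ℕₚ.<-≤-trans (ℕₚ.≤‴⇒≤ i<j) j≤len) ⟩ segment‴ i<j j≤len

      ∈-segment‴⁻ : ∀ {i j z} (i≤j : i ≤‴ j) (j≤len : j ≤ len T) →
                    z ∈ˡ vertices (segment‴ i≤j j≤len) → ∃ λ k → i ≤ k × k ≤ j × at T k ≡ z
      ∈-segment‴⁻ ℕ.≤‴-refl _ (here refl) = _ , ℕₚ.≤-refl , ℕₚ.≤-refl , refl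
      ∈-segment‴⁻ (ℕ.≤‴-step i<j) _ (here refl) = _ , ℕₚ.≤-refl , ℕₚ.<⇒≤ (ℕₚ.≤‴⇒≤ i<j) , refl
      ∈-segment‴⁻ (ℕ.≤‴-step i<j) j≤len (there z∈) with ∈-segment‴⁻ i<j j≤len z∈
      ... | k , i<k , k≤j , eq = k , ℕₚ.<⇒≤ i<k , k≤j , eq

      ∈-segment‴⁺ : ∀ {i j k} (i≤j : i ≤‴ j) (j≤len : j ≤ len T) → i ≤ k → k ≤ j →
                    at T k ∈ˡ vertices (segment‴ i≤j j≤len)
      ∈-segment‴⁺ ℕ.≤‴-refl _ i≤k k≤i rewrite ℕₚ.≤-antisym i≤k k≤i = here refl
      ∈-segment‴⁺ {i} {k = k} (ℕ.≤‴-step i<j) j≤len i≤k k≤j with i ℕ.≟ k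
      ... | yes refl = here refl
      ... | no i≢k = there (∈-segment‴⁺ i<j j≤len (ℕₚ.≤∧≢⇒< i≤k i≢k) k≤j)

      segment‴-unique : ∀ {i j} (i≤j : i ≤‴ j) (j≤len : j ≤ len T) →
                        Unique (vertices (segment‴ i≤j j≤len))
      segment‴-unique ℕ.≤‴-refl _ = [] ∷ []
      segment‴-unique {i} (ℕ.≤‴-step i<j) j≤len =
        ListAll.tabulate at-i∉ ∷ segment‴-unique i<j j≤len
        where
        at-i∉ : ∀ {z} → z ∈ˡ vertices (segment‴ i<j j≤len) → at T i ≢ z
        at-i∉ z∈ eq with ∈-segment‴⁻ i<j j≤len z∈
        ... | k , i<k , k≤j , refl =
          ℕₚ.<⇒≢ i<k (at-injective T (ℕₚ.<⇒≤ (ℕₚ.<-≤-trans i<k k≤len)) k≤len eq)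
          where k≤len = ℕₚ.≤-trans k≤j j≤len

    segment : ∀ {i j} → i ≤ j → j ≤ len T → Walk (at T i) (at T j)
    segment i≤j = segment‴ (ℕₚ.≤⇒≤‴ i≤j)

    ∈-segment⁻ : ∀ {i j z} (i≤j : i ≤ j) (j≤len : j ≤ len T) →
                 z ∈ˡ vertices (segment i≤j j≤len) → ∃ λ k → i ≤ k × k ≤ j × at T k ≡ z
    ∈-segment⁻ i≤j = ∈-segment‴⁻ (ℕₚ.≤⇒≤‴ i≤j)

    ∈-segment⁺ : ∀ {i j k} (i≤j : i ≤ j) (j≤len : j ≤ len T) → i ≤ k → k ≤ j →
                 at T k ∈ˡ vertices (segment i≤j j≤len)
    ∈-segment⁺ i≤j = ∈-segment‴⁺ (ℕₚ.≤⇒≤‴ i≤j)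

    segment-unique : ∀ {i j} (i≤j : i ≤ j) (j≤len : j ≤ len T) →
                     Unique (vertices (segment i≤j j≤len))
    segment-unique i≤j = segment‴-unique (ℕₚ.≤⇒≤‴ i≤j)

    ∈-segment⇒∈ₜ : ∀ {i j z} (i≤j : i ≤ j) (j≤len : j ≤ len T) →
                   z ∈ˡ vertices (segment i≤j j≤len) → z ∈ₜ T
    ∈-segment⇒∈ₜ i≤j j≤len z∈ with ∈-segment⁻ i≤j j≤len z∈
    ... | k , _ , k≤j , eq = k , ℕₚ.≤-trans k≤j j≤len , eq

    segments-disjoint : ∀ {i j i′ j′ z} (i≤j : i ≤ j) (j≤len : j ≤ len T)
                          (i′≤j′ : i′ ≤ j′) (j′≤len : j′ ≤ len T) → j < i′ →
                        z ∈ˡ vertices (segment i≤j j≤len) → z ∈ˡ vertices (segment i′≤j′ j′≤len) → ⊥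
    segments-disjoint i≤j j≤len i′≤j′ j′≤len j<i′ z∈ z∈′
      with ∈-segment⁻ i≤j j≤len z∈ | ∈-segment⁻ i′≤j′ j′≤len z∈′
    ... | k , _ , k≤j , eq | k′ , i′≤k′ , k′≤j′ , eq′ =
      ℕₚ.<⇒≢ (ℕₚ.≤-<-trans k≤j (ℕₚ.<-≤-trans j<i′ i′≤k′))
        (at-injective T (ℕₚ.≤-trans k≤j j≤len) (ℕₚ.≤-trans k′≤j′ j′≤len) (trans eq (sym eq′)))

    whole : Walk (at T 0) (at T (len T))
    whole = segment z≤n ℕₚ.≤-refl

    ∈-whole : ∀ {z} → z ∈ˡ vertices whole ⇔ z ∈ₜ T
    ∈-whole = mk⇔ (∈-segment⇒∈ₜ z≤n ℕₚ.≤-refl) λ where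
      (k , k≤len , refl) → ∈-segment⁺ z≤n ℕₚ.≤-refl z≤n k≤len

    ∈-split : ∀ {i z} (i<len : i < len T) → z ∈ₜ T →
              z ∈ˡ vertices (segment z≤n (ℕₚ.<⇒≤ i<len)) ⊎ z ∈ˡ vertices (segment i<len ℕₚ.≤-refl)
    ∈-split {i} i<len (k , k≤len , refl) with k ℕ.≤? i
    ... | yes k≤i = inj₁ (∈-segment⁺ z≤n (ℕₚ.<⇒≤ i<len) z≤n k≤i)
    ... | no k≰i = inj₂ (∈-segment⁺ i<len ℕₚ.≤-refl (ℕₚ.≰⇒> k≰i) k≤len)

  reverse : Track → Track
  reverse T = record
    { len          = len T
    ; at           = λ i → at T (len T ∸ i)
    ; linked       = λ {i} i<len → subst (λ k → Adj G (at T k) (at T (len T ∸ suc i)))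
                       (sym (ℕₚ.+-∸-assoc 1 i<len))
                       (Adj-sym G (linked T (ℕₚ.∸-monoʳ-< (s≤s z≤n) i<len)))
    ; at-injective = λ {i} {j} i≤len j≤len eq →
                       ℕₚ.∸-cancelˡ-≡ i≤len j≤len
                         (at-injective T (ℕₚ.m∸n≤m _ i) (ℕₚ.m∸n≤m _ j) eq)
    ; parity       = λ {i} i≤len → subst (λ b → at T (len T ∸ i) ∈ S ⇔ b ≡ true)
                       (even-∸ i (len-even T) i≤len) (parity T (ℕₚ.m∸n≤m _ i))
    ; len-even     = len-even T
    ; len>0        = len>0 T
    }

  reverse-at : ∀ T {k} → k ≤ len T → at (reverse T) (len T ∸ k) ≡ at T k
  reverse-at T k≤len = cong (at T) (ℕₚ.m∸[m∸n]≡n k≤len)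

  ∈ₜ-reverse : ∀ {T z} → z ∈ₜ reverse T ⇔ z ∈ₜ T
  ∈ₜ-reverse {T} = mk⇔
    (λ (i , i≤len , eq) → len T ∸ i , ℕₚ.m∸n≤m _ i , eq)
    (λ (k , k≤len , eq) → len T ∸ k , ℕₚ.m∸n≤m _ k , trans (reverse-at T k≤len) eq)

  private
    clamped-linked : ∀ {m i} (Q : Path G m) → i < m →
                     Adj G (vert Q (clamp m i)) (vert Q (clamp m (suc i)))
    clamped-linked {suc m} {i} Q (s≤s i≤m) =
      subst (λ k → Adj G (vert Q k) (vert Q (suc (clamp m i)))) (inject₁-clamp i≤m) (linked Q (clamp m i))

    ends≢⇒len>0 : ∀ {m} (Q : Path G m) → start Q ≢ end Q → 0 < m
    ends≢⇒len>0 {zero} Q start≢end = ⊥-elim (start≢end refl)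
    ends≢⇒len>0 {suc m} Q _ = s≤s z≤n

  toTrack : AltPath G S → Track
  toTrack P = record
    { len          = m
    ; at           = λ i → vert (path P) (clamp m i)
    ; linked       = clamped-linked (path P)
    ; at-injective = λ i≤m j≤m eq →
                       trans (sym (toℕ-clamp i≤m))
                         (trans (cong toℕ (distinct (path P) eq)) (toℕ-clamp j≤m))
    ; parity       = λ {i} i≤m → let open Equivalence; clamp-alt = alt P (clamp m i) in mk⇔
                       (λ at∈S → from (even⇔%2≡0 i)
                          (subst (λ k → k % 2 ≡ 0) (toℕ-clamp i≤m) (to clamp-alt at∈S)))
                       (λ i-even → from clamp-alt
                          (subst (λ k → k % 2 ≡ 0) (sym (toℕ-clamp i≤m)) (to (even⇔%2≡0 i) i-even)))
    ; len-even     = even-2* (t P)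
    ; len>0        = ends≢⇒len>0 (path P) (ends≢ P)
    }
    where m = 2 * t P

  toTrack-end : ∀ P → end (path P) ≡ at (toTrack P) (len (toTrack P))
  toTrack-end P = cong (vert (path P)) (Finₚ.toℕ-injective
    (trans (Finₚ.toℕ-fromℕ (2 * t P)) (sym (toℕ-clamp ℕₚ.≤-refl))))

  ∈V⇔∈ₜ : ∀ P {x} → (path P ∈V) x ⇔ x ∈ₜ toTrack P
  ∈V⇔∈ₜ P = mk⇔
    (λ (k , eq) → toℕ k , ℕₚ.≤-pred (Finₚ.toℕ<n k) ,
                  trans (cong (vert (path P)) (clamp-toℕ k)) eq)
    (λ (i , _ , eq) → clamp (2 * t P) i , eq)

-- Forbidden stars in a split graph

module Stars {n} {G : Graph n} {S : Subset n}
  (clique : IsClique G S) (independent : IsIndependent G (∁ S))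
  (K14-free : (K14 -Free) G) (K14e-free : (K14e -Free) G) where

  ∉S-nonadjacent : ∀ {x y} → x ∉ S → y ∉ S → ¬ Adj G x y
  ∉S-nonadjacent x∉S y∉S = independent _ _ (x∉p⇒x∈∁p x∉S) (x∉p⇒x∈∁p y∉S)

  S-adjacent : ∀ {x y} → x ∈ S → y ∈ S → x ≢ y → Adj G x y
  S-adjacent = clique _ _

  ∈S∉S⇒≢ : ∀ {x y} → x ∈ S → y ∉ S → x ≢ y
  ∈S∉S⇒≢ x∈S y∉S refl = y∉S x∈S

  private
    true≡ : ∀ {x y} → Adj G x y → true ≡ adj G x y
    true≡ = sym ∘ Equivalence.to T-≡

    false≡ : ∀ {x y} → ¬ Adj G x y → false ≡ adj G x y
    false≡ {x} {y} x≁y with adj G x y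
    ... | false = refl
    ... | true = ⊥-elim (x≁y _)

    loop-free : ∀ x → ¬ Adj G x x
    loop-free x x~x = Adj⇒≢ G x~x refl

    star-induces : (F : Graph 5) → (∀ i → adj F zero (suc i) ≡ true) →
                   ∀ c (ℓ : Vec (Fin n) 4) → VecUnique.Unique (c ∷ ℓ) → VecAll.All (Adj G c) ℓ →
                   (∀ i j → adj F (suc i) (suc j) ≡ adj G (Vec.lookup ℓ i) (Vec.lookup ℓ j)) →
                   InducedSub F G
    star-induces F centre c ℓ unique c~ℓ leaves =
      Vec.lookup (c ∷ ℓ) , VecUniqueₚ.lookup-injective unique _ _ , agree
      where
      agree : ∀ x y → adj F x y ≡ adj G (Vec.lookup (c ∷ ℓ) x) (Vec.lookup (c ∷ ℓ) y)
      agree zero zero = trans (irrefl F zero) (false≡ (loop-free c))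
      agree zero (suc j) = trans (centre j) (true≡ (lookup⁺ c~ℓ j))
      agree (suc i) zero =
        trans (Graph.sym F (suc i) zero) (trans (centre i) (true≡ (Adj-sym G (lookup⁺ c~ℓ i))))
      agree (suc i) (suc j) = leaves i j

  no-K14 : ∀ {c p a b d} → Adj G c p → Adj G c a → Adj G c b → Adj G c d →
           a ∉ S → b ∉ S → d ∉ S → a ≢ b → a ≢ d → b ≢ d → p ≢ a → p ≢ b → p ≢ d →
           ¬ Adj G p a → ¬ Adj G p b → ¬ Adj G p d → ⊥
  no-K14 {c} {p} {a} {b} {d} c~p c~a c~b c~d a∉S b∉S d∉S a≢b a≢d b≢d p≢a p≢b p≢d p≁a p≁b p≁d =
    K14-free (star-induces K14 (λ _ → refl) c (p ∷ a ∷ b ∷ d ∷ [])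
      ((Adj⇒≢ G c~p ∷ Adj⇒≢ G c~a ∷ Adj⇒≢ G c~b ∷ Adj⇒≢ G c~d ∷ []) ∷
       (p≢a ∷ p≢b ∷ p≢d ∷ []) ∷ (a≢b ∷ a≢d ∷ []) ∷ (b≢d ∷ []) ∷ [] ∷ [])
      (c~p ∷ c~a ∷ c~b ∷ c~d ∷ [])
      λ i j → false≡ (nonadjacent i j))
    where
    ℓ = p ∷ a ∷ b ∷ d ∷ []
    p≁ : VecAll.All (λ y → ¬ Adj G p y) (a ∷ b ∷ d ∷ [])
    p≁ = p≁a ∷ p≁b ∷ p≁d ∷ []
    I-leaves : VecAll.All (_∉ S) (a ∷ b ∷ d ∷ [])
    I-leaves = a∉S ∷ b∉S ∷ d∉S ∷ []
    nonadjacent : ∀ i j → ¬ Adj G (Vec.lookup ℓ i) (Vec.lookup ℓ j)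
    nonadjacent zero zero = loop-free p
    nonadjacent zero (suc j) = lookup⁺ p≁ j
    nonadjacent (suc i) zero = lookup⁺ p≁ i ∘ Adj-sym G
    nonadjacent (suc i) (suc j) = ∉S-nonadjacent (lookup⁺ I-leaves i) (lookup⁺ I-leaves j)

  no-K14e : ∀ {c p q a b} → Adj G c p → Adj G c q → Adj G c a → Adj G c b → Adj G p q →
            p ∈ S → a ∉ S → b ∉ S → a ≢ b → q ≢ a → q ≢ b →
            ¬ Adj G p a → ¬ Adj G p b → ¬ Adj G q a → ¬ Adj G q b → ⊥
  no-K14e {c} {p} {q} {a} {b} c~p c~q c~a c~b p~q p∈S a∉S b∉S a≢b q≢a q≢b p≁a p≁b q≁a q≁b =
    K14e-free (star-induces K14e (λ _ → refl) c ℓ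
      ((Adj⇒≢ G c~p ∷ Adj⇒≢ G c~q ∷ Adj⇒≢ G c~a ∷ Adj⇒≢ G c~b ∷ []) ∷
       (Adj⇒≢ G p~q ∷ ∈S∉S⇒≢ p∈S a∉S ∷ ∈S∉S⇒≢ p∈S b∉S ∷ []) ∷
       (q≢a ∷ q≢b ∷ []) ∷ (a≢b ∷ []) ∷ [] ∷ [])
      (c~p ∷ c~q ∷ c~a ∷ c~b ∷ [])
      agree)
    where
    ℓ = p ∷ q ∷ a ∷ b ∷ []
    p≁ : VecAll.All (λ y → ¬ Adj G p y) (a ∷ b ∷ [])
    p≁ = p≁a ∷ p≁b ∷ []
    q≁ : VecAll.All (λ y → ¬ Adj G q y) (a ∷ b ∷ [])
    q≁ = q≁a ∷ q≁b ∷ []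
    I-leaves : VecAll.All (_∉ S) (a ∷ b ∷ [])
    I-leaves = a∉S ∷ b∉S ∷ []
    agree : ∀ i j → leafEdge i j ≡ adj G (Vec.lookup ℓ i) (Vec.lookup ℓ j)
    agree zero zero = false≡ (loop-free p)
    agree zero (suc zero) = true≡ p~q
    agree zero (suc (suc j)) = false≡ (lookup⁺ p≁ j)
    agree (suc zero) zero = true≡ (Adj-sym G p~q)
    agree (suc zero) (suc zero) = false≡ (loop-free q)
    agree (suc zero) (suc (suc j)) = false≡ (lookup⁺ q≁ j)
    agree (suc (suc i)) zero = false≡ (lookup⁺ p≁ i ∘ Adj-sym G)
    agree (suc (suc i)) (suc zero) = false≡ (lookup⁺ q≁ i ∘ Adj-sym G)
    agree (suc (suc i)) (suc (suc j)) = false≡ (∉S-nonadjacent (lookup⁺ I-leaves i) (lookup⁺ I-leaves j))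

  neighbour-of-∉S : ∀ {x y} → x ∉ S → Adj G x y → y ∈ S
  neighbour-of-∉S {y = y} x∉S x~y with y ∈? S
  ... | yes y∈S = y∈S
  ... | no y∉S = ⊥-elim (∉S-nonadjacent x∉S y∉S x~y)

  four-I-neighbours : ∀ {c a b d e} → Adj G c a → Adj G c b → Adj G c d → Adj G c e →
                      a ∉ S → b ∉ S → d ∉ S → e ∉ S →
                      a ≢ b → a ≢ d → b ≢ d → e ≢ a → e ≢ b → e ≢ d → ⊥
  four-I-neighbours c~a c~b c~d c~e a∉S b∉S d∉S e∉S a≢b a≢d b≢d e≢a e≢b e≢d =
    no-K14 c~e c~a c~b c~d a∉S b∉S d∉S a≢b a≢d b≢d e≢a e≢b e≢d
      (∉S-nonadjacent e∉S a∉S) (∉S-nonadjacent e∉S b∉S) (∉S-nonadjacent e∉S d∉S)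

  -- An induced K₁,₃ centred in S, as I is independent.
  record Claw (s a b c : Fin n) : Set where
    field
      centre∈S : s ∈ S
      a∉S : a ∉ S
      b∉S : b ∉ S
      c∉S : c ∉ S
      a≢b : a ≢ b
      a≢c : a ≢ c
      b≢c : b ≢ c
      s~a : Adj G s a
      s~b : Adj G s b
      s~c : Adj G s c

  AdjacentToTwo : Fin n → Fin n → Fin n → Fin n → Set
  AdjacentToTwo s a b c = (Adj G s a × Adj G s b) ⊎ (Adj G s a × Adj G s c) ⊎ (Adj G s b × Adj G s c)

  two-of-three : ∀ {s a b c s′} → Claw s a b c → s′ ∈ S → s′ ≢ s → AdjacentToTwo s′ a b c
  two-of-three {s} {a} {b} {c} {s′} k s′∈S s′≢s =
    by-adjacency (Adj? G s′ a) (Adj? G s′ b) (Adj? G s′ c)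
    where
    open Claw k
    s~s′ = S-adjacent centre∈S s′∈S (s′≢s ∘ sym)
    by-adjacency : Dec (Adj G s′ a) → Dec (Adj G s′ b) → Dec (Adj G s′ c) → AdjacentToTwo s′ a b c
    by-adjacency (yes s′~a) (yes s′~b) _          = inj₁ (s′~a , s′~b)
    by-adjacency (yes s′~a) (no _)     (yes s′~c) = inj₂ (inj₁ (s′~a , s′~c))
    by-adjacency (no _)     (yes s′~b) (yes s′~c) = inj₂ (inj₂ (s′~b , s′~c))
    by-adjacency (no s′≁a)  (no s′≁b)  (no s′≁c)  =
      ⊥-elim (no-K14 s~s′ s~a s~b s~c a∉S b∉S c∉S a≢b a≢c b≢c
                (∈S∉S⇒≢ s′∈S a∉S) (∈S∉S⇒≢ s′∈S b∉S) (∈S∉S⇒≢ s′∈S c∉S) s′≁a s′≁b s′≁c)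
    by-adjacency (yes s′~a) (no s′≁b)  (no s′≁c)  =
      ⊥-elim (no-K14e s~s′ s~a s~b s~c s′~a s′∈S b∉S c∉S b≢c a≢b a≢c s′≁b s′≁c
                (∉S-nonadjacent a∉S b∉S) (∉S-nonadjacent a∉S c∉S))
    by-adjacency (no s′≁a)  (yes s′~b) (no s′≁c)  =
      ⊥-elim (no-K14e s~s′ s~b s~a s~c s′~b s′∈S a∉S c∉S a≢c (a≢b ∘ sym) b≢c s′≁a s′≁c
                (∉S-nonadjacent b∉S a∉S) (∉S-nonadjacent b∉S c∉S))
    by-adjacency (no s′≁a)  (no s′≁b)  (yes s′~c) =
      ⊥-elim (no-K14e s~s′ s~c s~a s~b s′~c s′∈S a∉S b∉S a≢b (a≢c ∘ sym) (b≢c ∘ sym) s′≁a s′≁b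
                (∉S-nonadjacent c∉S a∉S) (∉S-nonadjacent c∉S b∉S))

  adjacent-to-b-or-c : ∀ {s a b c s′} → Claw s a b c → s′ ∈ S → s′ ≢ s → Adj G s′ b ⊎ Adj G s′ c
  adjacent-to-b-or-c k s′∈S s′≢s with two-of-three k s′∈S s′≢s
  ... | inj₁ (_ , s′~b) = inj₁ s′~b
  ... | inj₂ (inj₁ (_ , s′~c)) = inj₂ s′~c
  ... | inj₂ (inj₂ (s′~b , _)) = inj₁ s′~b

module Cover {n} {G : Graph n} {S : Subset n} {h} (P : Fin h → AltPath G S)
  (3-connected : KConnected 3 G) (K14-free : (K14 -Free) G) (K14e-free : (K14e -Free) G)
  (split : IsSplitPartition G S) (cover : IsICover G S h P) where

  open Walks G
  open Tracks G S
  open Stars {G = G} {S = S} (proj₁ split) (proj₂ (proj₂ split)) K14-free K14e-free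
  open import Data.List.Membership.DecPropositional (Finₚ._≟_ {n}) using () renaming (_∈?_ to _∈ˡ?_)

  track : Fin h → Track
  track l = toTrack (P l)

  same-track : ∀ {l l′ x} → x ∈ₜ track l → x ∈ₜ track l′ → l ≡ l′
  same-track {l} {l′} x∈l x∈l′ with l Finₚ.≟ l′
  ... | yes l≡l′ = l≡l′
  ... | no l≢l′ = ⊥-elim (proj₁ cover l l′ l≢l′ _
                    (Equivalence.from (∈V⇔∈ₜ (P l)) x∈l)
                    (Equivalence.from (∈V⇔∈ₜ (P l′)) x∈l′))

  same-track-∈ : ∀ {l l′ y z} → y ∈ₜ track l → z ∈ₜ track l → y ∈ₜ track l′ → z ∈ₜ track l′
  same-track-∈ {z = z} y∈l z∈l y∈l′ = subst (λ k → z ∈ₜ track k) (same-track y∈l y∈l′) z∈l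

  I-covered : ∀ {x} → x ∉ S → ∃ λ l → x ∈ₜ track l
  I-covered x∉S with proj₂ cover _ (x∉p⇒x∈∁p x∉S)
  ... | l , x∈P , _ = l , Equivalence.to (∈V⇔∈ₜ (P l)) x∈P

  on-track? : ∀ x → Dec (∃ λ l → x ∈ₜ track l)
  on-track? x = Finₚ.any? (λ l → x ∈ₜ? track l)

  off-track⇒∈S : ∀ {x} → ¬ (∃ λ l → x ∈ₜ track l) → x ∈ S
  off-track⇒∈S {x} off with x ∈? S
  ... | yes x∈S = x∈S
  ... | no x∉S = ⊥-elim (off (I-covered x∉S))

  -- Splicing cover paths into a path

  Closed : List (Fin n) → Set
  Closed xs = ∀ {l y z} → y ∈ₜ track l → z ∈ₜ track l → y ∈ˡ xs → z ∈ˡ xs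

  record Block (x : Fin n) : Set where
    field
      {d₀ d₁} : Fin n
      walk    : Walk d₀ d₁
      d₀∈S    : d₀ ∈ S
      d₁∈S    : d₁ ∈ S
      unique  : Unique (vertices walk)
      closed  : Closed (vertices walk)
      tied    : ∀ {z} → z ∈ˡ vertices walk → z ≡ x ⊎ ∃ λ l → z ∈ₜ track l × x ∈ₜ track l

  block : ∀ x → Block x
  block x with on-track? x
  ... | yes (l , x∈l) = record
    { walk   = whole (track l)
    ; d₀∈S   = start∈S (track l)
    ; d₁∈S   = end∈S (track l)
    ; unique = segment-unique (track l) z≤n ℕₚ.≤-refl
    ; closed = λ y∈l′ z∈l′ y∈l → Equivalence.from (∈-whole (track l))
                 (same-track-∈ y∈l′ z∈l′ (Equivalence.to (∈-whole (track l)) y∈l))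
    ; tied   = λ z∈l → inj₂ (l , Equivalence.to (∈-whole (track l)) z∈l , x∈l)
    }
  ... | no off = record
    { walk   = [ x ]
    ; d₀∈S   = off-track⇒∈S off
    ; d₁∈S   = off-track⇒∈S off
    ; unique = [] ∷ []
    ; closed = λ { y∈l _ (here refl) → ⊥-elim (off (_ , y∈l)) }
    ; tied   = λ { (here refl) → inj₁ refl }
    }

  -- The u–v path front ++ back has its middle edge s₁s₂ inside the clique S, so the walk of
  -- any block missing from it can be spliced in there.
  record Absorbing (u v : Fin n) : Set where
    field
      {s₁ s₂}      : Fin n
      front        : Walk u s₁
      back         : Walk s₂ v
      s₁∈S         : s₁ ∈ S
      s₂∈S         : s₂ ∈ S
      front-unique : Unique (vertices front)
      back-unique  : Unique (vertices back)
      disjoint     : Disjoint (vertices front) (vertices back)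
      closed       : Closed (vertices front ++ vertices back)

    covered : List (Fin n)
    covered = vertices front ++ vertices back

  open Absorbing

  module _ {u v : Fin n} where

    module Extension (st : Absorbing u v) {x} (x∉ : x ∉ˡ covered st) where

      module B = Block (block x)

      F = vertices (front st)
      D = vertices B.walk
      R = vertices (back st)

      fresh : ∀ {z} → z ∈ˡ D → z ∉ˡ F ++ R
      fresh z∈D z∈cov with B.tied z∈D
      ... | inj₁ refl = x∉ z∈cov
      ... | inj₂ (l , z∈l , x∈l) = x∉ (closed st z∈l x∈l z∈cov)

      s₁~d₀ : Adj G (s₁ st) B.d₀
      s₁~d₀ = S-adjacent (s₁∈S st) B.d₀∈S λ s₁≡d₀ →
        fresh (first∈ B.walk) (∈-++⁺ˡ (subst (_∈ˡ F) s₁≡d₀ (last∈ (front st))))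

      front′ : Walk u B.d₁
      front′ = front st ++⟨ s₁~d₀ ⟩ B.walk

      F′≡ : vertices front′ ≡ F ++ D
      F′≡ = vertices-++ (front st) s₁~d₀ B.walk

      F′R-closed : Closed ((F ++ D) ++ R)
      F′R-closed y∈l z∈l y∈ with ∈-insert⁻ F D y∈
      ... | inj₁ y∈cov = ∈-insert⁺ˡ F D (closed st y∈l z∈l y∈cov)
      ... | inj₂ y∈D = ∈-insert⁺ʳ F R (B.closed y∈l z∈l y∈D)

      extended : Absorbing u v
      extended = record
        { front        = front′
        ; back         = back st
        ; s₁∈S         = B.d₁∈S
        ; s₂∈S         = s₂∈S st
        ; front-unique = subst Unique (sym F′≡) (Uniqueₚ.++⁺ (front-unique st) B.unique
                           λ (z∈F , z∈D) → fresh z∈D (∈-++⁺ˡ z∈F))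
        ; back-unique  = back-unique st
        ; disjoint     = λ (z∈F′ , z∈R) →
                           Data.Sum.[ (λ z∈F → disjoint st (z∈F , z∈R)) , (λ z∈D → fresh z∈D (∈-++⁺ʳ F z∈R)) ]′
                             (∈-++⁻ F (subst (_ ∈ˡ_) F′≡ z∈F′))
        ; closed       = λ y∈l z∈l y∈ → subst (λ xs → _ ∈ˡ xs ++ R) (sym F′≡)
                           (F′R-closed y∈l z∈l (subst (λ xs → _ ∈ˡ xs ++ R) F′≡ y∈))
        }

      longer : length (front st) < length front′
      longer = subst (length (front st) <_) (sym (length-++ (front st) s₁~d₀ B.walk)) (s≤s (ℕₚ.m≤m+n _ _))

    complete : (st : Absorbing u v) → (∀ x → x ∈ˡ covered st) → HamPath G u v
    complete st spanning =
      hamiltonian joined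
        (subst Unique (sym joined≡) (Uniqueₚ.++⁺ (front-unique st) (back-unique st) (disjoint st)))
        λ x → subst (x ∈ˡ_) (sym joined≡) (spanning x)
      where
      s₁~s₂ = S-adjacent (s₁∈S st) (s₂∈S st) λ s₁≡s₂ →
        disjoint st (last∈ (front st) , subst (_∈ˡ vertices (back st)) (sym s₁≡s₂) (first∈ (back st)))
      joined = front st ++⟨ s₁~s₂ ⟩ back st
      joined≡ = vertices-++ (front st) s₁~s₂ (back st)

    absorb : ∀ fuel (st : Absorbing u v) → n ≤ suc (length (front st)) + fuel → HamPath G u v
    absorb fuel st n≤ with Finₚ.all? (λ x → x ∈ˡ? covered st)
    ... | yes spanning = complete st spanning
    ... | no ¬spanning with Finₚ.¬∀⟶∃¬ n _ (λ x → x ∈ˡ? covered st) ¬spanning | fuel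
    ...   | x , x∉ | zero = ⊥-elim (ℕₚ.<⇒≱ (length<-outside (front st) (front-unique st) (x∉ ∘ ∈-++⁺ˡ))
                                          (subst (n ≤_) (ℕₚ.+-identityʳ _) n≤))
    ...   | x , x∉ | suc fuel′ = absorb fuel′ extended
                (ℕₚ.≤-trans n≤ (subst (_≤ suc (length (front extended)) + fuel′) (sym (ℕₚ.+-suc _ fuel′))
                  (ℕₚ.+-monoˡ-≤ fuel′ (s≤s longer))))
      where open Extension st x∉

  -- Saturated paths

  Saturated : Track → Set
  Saturated Q = ∀ {x y} → x ∈ₜ Q → x ∉ S → Adj G x y → y ∈ₜ Q

  ClawFree : Track → Set
  ClawFree Q = ∀ {s a b c} → Claw s a b c → a ∈ₜ Q → b ∈ₜ Q → c ∈ₜ Q → ⊥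

  module SaturatedPath (Q : Track) (saturated : Saturated Q) (claw-free : ClawFree Q) where

    private
      claw-free-at : ∀ {e a b c} → a ≤ len Q → b ≤ len Q → c ≤ len Q → a ≢ b → a ≢ c → b ≢ c →
                     at Q a ∉ S → at Q b ∉ S → at Q c ∉ S →
                     Adj G (at Q e) (at Q a) → Adj G (at Q e) (at Q b) → Adj G (at Q e) (at Q c) → ⊥
      claw-free-at a≤ b≤ c≤ a≢b a≢c b≢c a∉S b∉S c∉S e~a e~b e~c = claw-free
        (record
          { centre∈S = neighbour-of-∉S a∉S (Adj-sym G e~a)
          ; a∉S = a∉S ; b∉S = b∉S ; c∉S = c∉S
          ; a≢b = a≢b ∘ at-injective Q a≤ b≤
          ; a≢c = a≢c ∘ at-injective Q a≤ c≤
          ; b≢c = b≢c ∘ at-injective Q b≤ c≤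
          ; s~a = e~a ; s~b = e~b ; s~c = e~c
          })
        (at∈ₜ Q a≤) (at∈ₜ Q b≤) (at∈ₜ Q c≤)

    -- at Q (suc i) has a third neighbour, and it is an end of Q: an inner vertex at Q e would be
    -- the centre of the claw at Q (e - 1), at Q (e + 1), at Q (suc i).
    end-neighbour : ∀ {i} → suc i < len Q → at Q (suc i) ∉ S →
                    ∃ λ e → (e ≡ 0 ⊎ e ≡ len Q) × e ≢ i × e ≢ suc (suc i) ×
                            Adj G (at Q (suc i)) (at Q e)
    end-neighbour {i} si<len x∉S
      with neighbour-avoiding G 3-connected (at Q (suc i)) (at Q i) (at Q (suc (suc i)))
    ... | y , x~y , y≢previous , y≢next
      with saturated (at∈ₜ Q (ℕₚ.<⇒≤ si<len)) x∉S x~y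
    ... | zero , _ , refl = zero , inj₁ refl , (λ { refl → y≢previous refl }) , (λ ()) , x~y
    ... | suc e , e<len , refl with suc e ℕ.≟ len Q
    ...   | yes se≡len =
      suc e , inj₂ se≡len , (λ { refl → y≢previous refl }) , (λ { refl → y≢next refl }) , x~y
    ...   | no se≢len = ⊥-elim (claw-free-at (ℕₚ.<⇒≤ e<len′) se<len (ℕₚ.<⇒≤ si<len)
              (λ ()) (λ { refl → y≢next refl }) (λ { refl → y≢previous refl })
              (previous∉S Q e<len′ e∈S) (next∉S Q se<len e∈S) x∉S
              (Adj-sym G (linked Q e<len′)) (linked Q se<len) (Adj-sym G x~y))
      where
      se<len = ℕₚ.≤∧≢⇒< e<len se≢len
      e<len′ = ℕₚ.<-trans (ℕₚ.n<1+n e) se<len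
      e∈S = neighbour-of-∉S x∉S x~y

    private
      module Ends {k} (len≡ : len Q ≡ suc (suc k)) where

        1<len : 1 < len Q
        1<len = subst (1 <_) (sym len≡) (s≤s (s≤s z≤n))

        sk<len : suc k < len Q
        sk<len = subst (suc k <_) (sym len≡) ℕₚ.≤-refl

        at1∉S : at Q 1 ∉ S
        at1∉S = next∉S Q (ℕₚ.<-trans (s≤s z≤n) 1<len) (start∈S Q)

        at-sk∉S : at Q (suc k) ∉ S
        at-sk∉S = previous∉S Q sk<len (subst (λ j → at Q j ∈ S) len≡ (end∈S Q))

        first-edge : len Q ≢ 2 × Adj G (at Q 1) (at Q (len Q))
        first-edge with end-neighbour 1<len at1∉S
        ... | _ , inj₁ refl , e≢0 , _ , _ = ⊥-elim (e≢0 refl)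
        ... | _ , inj₂ refl , _ , e≢2 , 1~len = e≢2 , 1~len

        last-edge : Adj G (at Q (suc k)) (at Q 0)
        last-edge with end-neighbour sk<len at-sk∉S
        ... | _ , inj₁ refl , _ , _ , sk~0 = sk~0
        ... | _ , inj₂ refl , _ , e≢len , _ = ⊥-elim (e≢len len≡)

        -- For len Q ≥ 6 the third neighbour of at Q 3 makes an end of Q the centre of a claw.
        module Long (6≤len : 6 ≤ len Q) where

          3<len = ℕₚ.≤-trans (s≤s (s≤s (s≤s (s≤s z≤n)))) 6≤len
          4≤k : 4 ≤ k
          4≤k = ℕₚ.≤-pred (ℕₚ.≤-pred (subst (6 ≤_) len≡ 6≤len))
          at3∉S : at Q 3 ∉ S
          at3∉S = next∉S Q (ℕₚ.<-trans (ℕₚ.n<1+n 2) 3<len) (neighbour-of-∉S at1∉S (linked Q 1<len))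

          claw-at : ∀ {e} → Adj G (at Q e) (at Q 1) → Adj G (at Q e) (at Q 3) →
                    Adj G (at Q e) (at Q (suc k)) → ⊥
          claw-at = claw-free-at (ℕₚ.<⇒≤ 1<len) (ℕₚ.<⇒≤ 3<len) (ℕₚ.<⇒≤ sk<len) (λ ())
            (ℕₚ.<⇒≢ (s≤s (ℕₚ.≤-trans (s≤s z≤n) 4≤k))) (ℕₚ.<⇒≢ (s≤s (ℕₚ.<⇒≤ 4≤k)))
            at1∉S at3∉S at-sk∉S

          impossible : ⊥
          impossible with end-neighbour 3<len at3∉S
          ... | _ , inj₁ refl , _ , _ , 3~0 =
            claw-at (linked Q (ℕₚ.<-trans (s≤s z≤n) 1<len)) (Adj-sym G 3~0) (Adj-sym G last-edge)
          ... | _ , inj₂ refl , _ , _ , 3~len =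
            claw-at (Adj-sym G (proj₂ first-edge)) (Adj-sym G 3~len)
              (subst (λ j → Adj G (at Q j) (at Q (suc k))) (sym len≡) (Adj-sym G (linked Q sk<len)))

    length-four : len Q ≡ 4 × Adj G (at Q 0) (at Q 3)
    length-four = len≡4 , subst (λ j → Adj G (at Q 0) (at Q (suc (j ∸ 2)))) len≡4 (Adj-sym G last-edge)
      where
      2≤len = 0<even⇒2≤ (len>0 Q) (len-even Q)
      open Ends (sym (ℕₚ.m+[n∸m]≡n 2≤len))
      len≡4 = even-2<m<6⇒m≡4 (len-even Q) (ℕₚ.≤∧≢⇒< 2≤len (proj₁ first-edge ∘ sym))
                (ℕₚ.≰⇒> Long.impossible)

  -- (ii) Hamiltonian paths between the ends of a cover path

  module Through (c : Fin h) where

    Q = track c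

    Rerouting : Set
    Rerouting = Absorbing (at Q 0) (at Q (len Q))

    record Detour : Set where
      field
        X Y      : List (Fin n)
        X-unique : Unique X
        Y-unique : Unique Y
        X∩Y      : Disjoint X Y
        off-Q    : ∀ {z} → z ∈ˡ X ++ Y → ¬ z ∈ₜ Q
        XY-closed : Closed (X ++ Y)

    track-detour : ∀ {l} → l ≢ c → (X Y : List (Fin n)) → Unique X → Unique Y → Disjoint X Y →
                   (∀ {z} → z ∈ˡ X ++ Y ⇔ z ∈ₜ track l) → Detour
    track-detour l≢c X Y X-unique Y-unique X∩Y ∈XY⇔ = record
      { X = X ; Y = Y ; X-unique = X-unique ; Y-unique = Y-unique ; X∩Y = X∩Y
      ; off-Q  = λ z∈XY z∈Q → l≢c (same-track (Equivalence.to ∈XY⇔ z∈XY) z∈Q)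
      ; XY-closed = λ y∈l′ z∈l′ y∈XY →
                      Equivalence.from ∈XY⇔ (same-track-∈ y∈l′ z∈l′ (Equivalence.to ∈XY⇔ y∈XY))
      }

    module Cut {i} (i<len : i < len Q) where

      Q₁ : Walk (at Q 0) (at Q i)
      Q₁ = segment Q z≤n (ℕₚ.<⇒≤ i<len)

      Q₂ : Walk (at Q (suc i)) (at Q (len Q))
      Q₂ = segment Q i<len ℕₚ.≤-refl

      on-Q₁ : ∀ {z} → z ∈ˡ vertices Q₁ → z ∈ₜ Q
      on-Q₁ = ∈-segment⇒∈ₜ Q z≤n (ℕₚ.<⇒≤ i<len)

      on-Q₂ : ∀ {z} → z ∈ˡ vertices Q₂ → z ∈ₜ Q
      on-Q₂ = ∈-segment⇒∈ₜ Q i<len ℕₚ.≤-refl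

      module Splice (D : Detour) where

        open Detour D

        F = vertices Q₁ ++ X
        B = Y ++ vertices Q₂

        F-unique : Unique F
        F-unique = Uniqueₚ.++⁺ (segment-unique Q z≤n (ℕₚ.<⇒≤ i<len)) X-unique
          λ (z∈Q₁ , z∈X) → off-Q (∈-++⁺ˡ z∈X) (on-Q₁ z∈Q₁)

        B-unique : Unique B
        B-unique = Uniqueₚ.++⁺ Y-unique (segment-unique Q i<len ℕₚ.≤-refl)
          λ (z∈Y , z∈Q₂) → off-Q (∈-++⁺ʳ X z∈Y) (on-Q₂ z∈Q₂)

        separated : ∀ {z} → z ∈ˡ F → z ∉ˡ B
        separated z∈F z∈B with ∈-++⁻ (vertices Q₁) z∈F | ∈-++⁻ Y z∈B
        ... | inj₁ z∈Q₁ | inj₁ z∈Y  = off-Q (∈-++⁺ʳ X z∈Y) (on-Q₁ z∈Q₁)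
        ... | inj₁ z∈Q₁ | inj₂ z∈Q₂ =
          segments-disjoint Q z≤n (ℕₚ.<⇒≤ i<len) i<len ℕₚ.≤-refl ℕₚ.≤-refl z∈Q₁ z∈Q₂
        ... | inj₂ z∈X  | inj₁ z∈Y  = X∩Y (z∈X , z∈Y)
        ... | inj₂ z∈X  | inj₂ z∈Q₂ = off-Q (∈-++⁺ˡ z∈X) (on-Q₂ z∈Q₂)

        on-Q⇒∈F++B : ∀ {l y z} → y ∈ₜ track l → z ∈ₜ track l → y ∈ₜ Q → z ∈ˡ F ++ B
        on-Q⇒∈F++B y∈l z∈l y∈Q = ∈-middle⁺ (vertices Q₁) X Y (vertices Q₂)
          (Data.Sum.map₂ inj₂ (∈-split Q i<len (same-track-∈ y∈l z∈l y∈Q)))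

        F++B-closed : Closed (F ++ B)
        F++B-closed y∈l z∈l y∈ with ∈-middle⁻ (vertices Q₁) X Y (vertices Q₂) y∈
        ... | inj₁ y∈Q₁        = on-Q⇒∈F++B y∈l z∈l (on-Q₁ y∈Q₁)
        ... | inj₂ (inj₂ y∈Q₂) = on-Q⇒∈F++B y∈l z∈l (on-Q₂ y∈Q₂)
        ... | inj₂ (inj₁ y∈XY) =
          ∈-middle⁺ (vertices Q₁) X Y (vertices Q₂) (inj₂ (inj₁ (XY-closed y∈l z∈l y∈XY)))

        splice : ∀ {s₁ s₂} (front : Walk (at Q 0) s₁) (back : Walk s₂ (at Q (len Q))) →
                 vertices front ≡ F → vertices back ≡ B → s₁ ∈ S → s₂ ∈ S → Rerouting
        splice front back front≡ back≡ s₁∈S s₂∈S = record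
          { front        = front
          ; back         = back
          ; s₁∈S         = s₁∈S
          ; s₂∈S         = s₂∈S
          ; front-unique = subst Unique (sym front≡) F-unique
          ; back-unique  = subst Unique (sym back≡) B-unique
          ; disjoint     = λ (z∈F , z∈B) →
                             separated (subst (_ ∈ˡ_) front≡ z∈F) (subst (_ ∈ˡ_) back≡ z∈B)
          ; closed       = λ y∈l z∈l y∈ → subst₂ (λ F′ B′ → _ ∈ˡ F′ ++ B′) (sym front≡) (sym back≡)
                             (F++B-closed y∈l z∈l (subst₂ (λ F′ B′ → _ ∈ˡ F′ ++ B′) front≡ back≡ y∈))
          }

      module _ (x∉S : at Q (suc i) ∉ S) {w} (w∈S : w ∈ S) (w∉Q : ¬ w ∈ₜ Q)
               (x~w : Adj G (at Q (suc i)) w) where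

        private
          x = at Q (suc i)

        at-i∈S : at Q i ∈ S
        at-i∈S = neighbour-of-∉S x∉S (Adj-sym G (linked Q i<len))

        via-outsider : ¬ (∃ λ l → w ∈ₜ track l) → Rerouting
        via-outsider off =
          Splice.splice D Q₁ (w ∷⟨ Adj-sym G x~w ⟩ Q₂) (sym (++-identityʳ _)) refl at-i∈S w∈S
          where
          D : Detour
          D = record
            { X = [] ; Y = w ∷ [] ; X-unique = [] ; Y-unique = [] ∷ [] ; X∩Y = λ { (() , _) }
            ; off-Q = λ { (here refl) → w∉Q }
            ; XY-closed = λ { y∈l _ (here refl) → ⊥-elim (off (_ , y∈l)) }
            }

        via-end : ∀ {l} (T : Track) → (∀ {z} → z ∈ₜ T ⇔ z ∈ₜ track l) → l ≢ c → at T (len T) ≡ w →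
                  Rerouting
        via-end T T≈l l≢c end≡w =
          Splice.splice D Q₁ (whole T ++⟨ end~x ⟩ Q₂)
            (sym (++-identityʳ _)) (vertices-++ (whole T) end~x Q₂) at-i∈S (start∈S T)
          where
          end~x = subst (λ y → Adj G y x) (sym end≡w) (Adj-sym G x~w)
          D = track-detour l≢c [] (vertices (whole T)) [] (segment-unique T z≤n ℕₚ.≤-refl)
                (λ { (() , _) })
                (mk⇔ (Equivalence.to T≈l ∘ Equivalence.to (∈-whole T))
                     (Equivalence.from (∈-whole T) ∘ Equivalence.from T≈l))

        via-inside : ∀ {l k} (T : Track) → (∀ {z} → z ∈ₜ T ⇔ z ∈ₜ track l) → l ≢ c →
                     (k<len : k < len T) → at T k ≡ w → Adj G (at Q i) (at T (suc k)) → Rerouting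
        via-inside {l} T T≈l l≢c k<len at-k≡w at-i~next =
          Splice.splice D (Q₁ ++⟨ at-i~next ⟩ T₂) (T₁ ++⟨ w~x ⟩ Q₂)
            (vertices-++ Q₁ at-i~next T₂) (vertices-++ T₁ w~x Q₂) (end∈S T) (start∈S T)
          where
          T₁ = segment T z≤n (ℕₚ.<⇒≤ k<len)
          T₂ = segment T k<len ℕₚ.≤-refl
          w~x = subst (λ y → Adj G y x) (sym at-k≡w) (Adj-sym G x~w)
          ∈T₂T₁⇔ : ∀ {z} → z ∈ˡ vertices T₂ ++ vertices T₁ ⇔ z ∈ₜ track l
          ∈T₂T₁⇔ = mk⇔
            (λ z∈ → Equivalence.to T≈l
              (Data.Sum.[ ∈-segment⇒∈ₜ T k<len ℕₚ.≤-refl , ∈-segment⇒∈ₜ T z≤n (ℕₚ.<⇒≤ k<len) ]′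
                (∈-++⁻ (vertices T₂) z∈)))
            (λ z∈l → Data.Sum.[ ∈-++⁺ʳ (vertices T₂) , ∈-++⁺ˡ ]′
              (∈-split T k<len (Equivalence.from T≈l z∈l)))
          D = track-detour l≢c (vertices T₂) (vertices T₁) (segment-unique T k<len ℕₚ.≤-refl)
                (segment-unique T z≤n (ℕₚ.<⇒≤ k<len))
                (λ (z∈T₂ , z∈T₁) →
                  segments-disjoint T z≤n (ℕₚ.<⇒≤ k<len) k<len ℕₚ.≤-refl ℕₚ.≤-refl z∈T₁ z∈T₂)
                ∈T₂T₁⇔

        -- w is an inner vertex of its cover path, so its two neighbours there lie in I and,
        -- together with x, form a claw centred at w; at Q i sees one of those two neighbours.
        via-interior : ∀ {l k} → l ≢ c → suc k < len (track l) → at (track l) (suc k) ≡ w →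
                       Rerouting
        via-interior {l} {k} l≢c sk<len at≡w = towards (adjacent-to-b-or-c claw at-i∈S at-i≢w)
          where
          L = track l
          k<len = ℕₚ.<-trans (ℕₚ.n<1+n k) sk<len
          off-Q : ∀ {j} → j ≤ len L → x ≢ at L j
          off-Q j≤len x≡ = l≢c (same-track (at∈ₜ L j≤len) (subst (_∈ₜ Q) x≡ (at∈ₜ Q i<len)))
          claw : Claw w x (at L k) (at L (suc (suc k)))
          claw = record
            { centre∈S = w∈S
            ; a∉S = x∉S
            ; b∉S = previous∉S L k<len (subst (_∈ S) (sym at≡w) w∈S)
            ; c∉S = next∉S L sk<len (subst (_∈ S) (sym at≡w) w∈S)
            ; a≢b = off-Q (ℕₚ.<⇒≤ k<len)
            ; a≢c = off-Q sk<len
            ; b≢c = ℕₚ.<⇒≢ (ℕₚ.m≤n⇒m≤1+n (ℕₚ.n<1+n k)) ∘ at-injective L (ℕₚ.<⇒≤ k<len) sk<len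
            ; s~a = Adj-sym G x~w
            ; s~b = subst (λ y → Adj G y (at L k)) at≡w (Adj-sym G (linked L k<len))
            ; s~c = subst (λ y → Adj G y (at L (suc (suc k)))) at≡w (linked L sk<len)
            }
          at-i≢w : at Q i ≢ w
          at-i≢w at-i≡w = w∉Q (subst (_∈ₜ Q) at-i≡w (at∈ₜ Q (ℕₚ.<⇒≤ i<len)))
          towards : Adj G (at Q i) (at L k) ⊎ Adj G (at Q i) (at L (suc (suc k))) → Rerouting
          towards (inj₂ at-i~next) = via-inside L (λ {z} → mk⇔ id id) l≢c sk<len at≡w at-i~next
          towards (inj₁ at-i~previous) =
            via-inside (reverse L) (λ {z} → ∈ₜ-reverse {L} {z}) l≢c
              (ℕₚ.∸-monoʳ-< (s≤s z≤n) (ℕₚ.<⇒≤ sk<len))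
              (trans (reverse-at L (ℕₚ.<⇒≤ sk<len)) at≡w)
              (subst (λ j → Adj G (at Q i) (at L j)) (sym (∸-suc-∸ (ℕₚ.<⇒≤ sk<len))) at-i~previous)

        via-track : ∀ {l k} → l ≢ c → k ≤ len (track l) → at (track l) k ≡ w → Rerouting
        via-track {l} {k} l≢c k≤len at≡w with k ℕ.≟ len (track l)
        ... | yes refl = via-end (track l) (λ {z} → mk⇔ id id) l≢c at≡w
        via-track {l} {zero} l≢c k≤len at≡w | no _ =
          via-end (reverse (track l)) (λ {z} → ∈ₜ-reverse {track l} {z}) l≢c
            (trans (cong (at (track l)) (ℕₚ.n∸n≡0 (len (track l)))) at≡w)
        via-track {l} {suc k} l≢c k≤len at≡w | no k≢len =
          via-interior l≢c (ℕₚ.≤∧≢⇒< k≤len k≢len) at≡w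

        rerouted : Rerouting
        rerouted with on-track? w
        ... | no off = via-outsider off
        ... | yes (l , k , k≤len , at≡w) = via-track (λ { refl → w∉Q (k , k≤len , at≡w) }) k≤len at≡w

    outsider-in-S : ∀ {x} → ¬ x ∈ₜ Q → ∃ λ w → w ∈ S × ¬ w ∈ₜ Q
    outsider-in-S {x} x∉Q with x ∈? S
    ... | yes x∈S = x , x∈S , x∉Q
    ... | no x∉S with I-covered x∉S
    ...   | l , x∈l =
      at (track l) 0 , start∈S (track l) , x∉Q ∘ same-track-∈ (at∈ₜ (track l) z≤n) x∈l

    second-outsider : 13 ≤ n → len Q ≡ 4 → ∀ {w₀} → w₀ ∈ S → ¬ w₀ ∈ₜ Q →
                      ∃ λ w₁ → w₁ ∈ S × ¬ w₁ ∈ₜ Q × w₁ ≢ w₀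
    second-outsider 13≤n len≡4 {w₀} w₀∈S w₀∉Q
      with Finₚ.any? (λ x → ¬? (x ∈ₜ? Q) ×-dec ¬? (x Finₚ.≟ w₀))
    ... | no none = ⊥-elim (ℕₚ.<⇒≱ (s≤s (s≤s (s≤s (s≤s (s≤s (s≤s (s≤s z≤n))))))) (ℕₚ.≤-trans 13≤n
                      (subst (λ m → n ≤ suc (suc m)) len≡4 (n≤len+2 Q λ {x} x∉Q →
                        decidable-stable (x Finₚ.≟ w₀) λ x≢w₀ → none (x , x∉Q , x≢w₀)))))
    ... | yes (x , x∉Q , x≢w₀) with x ∈? S
    ...   | yes x∈S = x , x∈S , x∉Q , x≢w₀
    ...   | no x∉S with I-covered x∉S
    ...     | l , x∈l with at (track l) 0 Finₚ.≟ w₀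
    ...       | no start≢w₀ =
      _ , start∈S (track l) , x∉Q ∘ same-track-∈ (at∈ₜ (track l) z≤n) x∈l , start≢w₀
    ...       | yes start≡w₀ =
      _ , end∈S (track l) , x∉Q ∘ same-track-∈ (at∈ₜ (track l) ℕₚ.≤-refl) x∈l ,
      start≢end (track l) ∘ trans start≡w₀ ∘ sym

    -- With w₀, w₁ off a saturated Q, the start of Q (adjacent to at Q 1, at Q 3, w₀, w₁)
    -- is the centre of an induced K₁,₄ + e.
    module Trapped (13≤n : 13 ≤ n) (saturated : Saturated Q)
                   {w₀} (w₀∈S : w₀ ∈ S) (w₀∉Q : ¬ w₀ ∈ₜ Q) where

      claw-free : ClawFree Q
      claw-free {s} k a∈Q b∈Q c∈Q with s Finₚ.≟ w₀
      ... | yes refl = w₀∉Q (saturated a∈Q (Claw.a∉S k) (Adj-sym G (Claw.s~a k)))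
      ... | no s≢w₀ with adjacent-to-b-or-c k w₀∈S (s≢w₀ ∘ sym)
      ...   | inj₁ w₀~b = w₀∉Q (saturated b∈Q (Claw.b∉S k) (Adj-sym G w₀~b))
      ...   | inj₂ w₀~c = w₀∉Q (saturated c∈Q (Claw.c∉S k) (Adj-sym G w₀~c))

      open SaturatedPath Q saturated claw-free

      K14e-at-start : ∀ {w₁} → w₁ ∈ S → ¬ w₁ ∈ₜ Q → w₁ ≢ w₀ → ⊥
      K14e-at-start {w₁} w₁∈S w₁∉Q w₁≢w₀ =
        no-K14e (start~ w₀∈S w₀∉Q) (start~ w₁∈S w₁∉Q) (linked Q 0<len) (proj₂ length-four)
          (S-adjacent w₀∈S w₁∈S (w₁≢w₀ ∘ sym)) w₀∈S at1∉S at3∉S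
          (ℕₚ.<⇒≢ (s≤s (s≤s z≤n)) ∘ at-injective Q 1≤len 3≤len)
          (∈S∉S⇒≢ w₁∈S at1∉S) (∈S∉S⇒≢ w₁∈S at3∉S)
          (off-Q-nonadjacent w₀∉Q 1≤len at1∉S) (off-Q-nonadjacent w₀∉Q 3≤len at3∉S)
          (off-Q-nonadjacent w₁∉Q 1≤len at1∉S) (off-Q-nonadjacent w₁∉Q 3≤len at3∉S)
        where
        len≡4 = proj₁ length-four
        0<len = subst (0 <_) (sym len≡4) (s≤s z≤n)
        1≤len = subst (1 ≤_) (sym len≡4) (s≤s z≤n)
        3<len = subst (3 <_) (sym len≡4) ℕₚ.≤-refl
        3≤len = ℕₚ.<⇒≤ 3<len
        at1∉S = next∉S Q 0<len (start∈S Q)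
        at3∉S = previous∉S Q 3<len (subst (λ j → at Q j ∈ S) len≡4 (end∈S Q))
        start~ : ∀ {w} → w ∈ S → ¬ w ∈ₜ Q → Adj G (at Q 0) w
        start~ w∈S w∉Q =
          S-adjacent (start∈S Q) w∈S λ start≡w → w∉Q (subst (_∈ₜ Q) start≡w (at∈ₜ Q z≤n))
        off-Q-nonadjacent : ∀ {w j} → ¬ w ∈ₜ Q → j ≤ len Q → at Q j ∉ S → ¬ Adj G w (at Q j)
        off-Q-nonadjacent w∉Q j≤len at∉S w~at = w∉Q (saturated (at∈ₜ Q j≤len) at∉S (Adj-sym G w~at))

      impossible : ⊥
      impossible with second-outsider 13≤n (proj₁ length-four) w₀∈S w₀∉Q
      ... | w₁ , w₁∈S , w₁∉Q , w₁≢w₀ = K14e-at-start w₁∈S w₁∉Q w₁≢w₀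

    Escape : Set
    Escape = ∃ λ x → ∃ λ w → x ∈ₜ Q × x ∉ S × ¬ w ∈ₜ Q × Adj G x w

    escape? : Dec Escape
    escape? = Finₚ.any? λ x → Finₚ.any? λ w →
      (x ∈ₜ? Q) ×-dec ¬? (x ∈? S) ×-dec ¬? (w ∈ₜ? Q) ×-dec Adj? G x w

    escape⇒absorbing : Escape → Rerouting
    escape⇒absorbing (_ , w , (zero , _ , refl) , x∉S , _) = ⊥-elim (x∉S (start∈S Q))
    escape⇒absorbing (_ , w , (suc i , si≤len , refl) , x∉S , w∉Q , x~w) =
      Cut.rerouted si≤len x∉S (neighbour-of-∉S x∉S x~w) w∉Q x~w

    hamiltonian-through : 13 ≤ n → HamPath G (at Q 0) (at Q (len Q))
    hamiltonian-through 13≤n with Finₚ.all? (_∈ₜ? Q)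
    ... | yes spanning = hamiltonian (whole Q) (segment-unique Q z≤n ℕₚ.≤-refl)
                           (λ x → Equivalence.from (∈-whole Q) (spanning x))
    ... | no ¬spanning with escape?
    ...   | yes escape = absorb n (escape⇒absorbing escape) (ℕₚ.m≤n+m n _)
    ...   | no trapped with Finₚ.¬∀⟶∃¬ n _ (_∈ₜ? Q) ¬spanning
    ...     | x₀ , x₀∉Q with outsider-in-S x₀∉Q
    ...       | w₀ , w₀∈S , w₀∉Q = ⊥-elim (Trapped.impossible 13≤n saturated w₀∈S w₀∉Q)
      where
      saturated : Saturated Q
      saturated {x} {y} x∈Q x∉S x~y =
        decidable-stable (y ∈ₜ? Q) λ y∉Q → trapped (x , y , x∈Q , x∉S , y∉Q , x~y)

  -- (i) No single cover path through all vertices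

  module Spanning (l : Fin h) (spanning : ∀ x → x ∈ₜ track l) where

    Q = track l

    position : Fin n → ℕ
    position x = proj₁ (spanning x)

    position≤len : ∀ x → position x ≤ len Q
    position≤len x = proj₁ (proj₂ (spanning x))

    at-position : ∀ x → at Q (position x) ≡ x
    at-position x = proj₂ (proj₂ (spanning x))

    -- Every vertex of S is adjacent to two leaves of the claw, hence to at most one further
    -- vertex of I.  So the three S-neighbours of the I-vertices odd j that are not leaves are
    -- pairwise distinct, which gives 3 · half ≤ (half + 1) + 3 · 3.
    module Counting {s₀ a b c} (claw : Claw s₀ a b c) where

      open Claw claw

      half : ℕ
      half = t (P l)

      odd : Fin half → Fin n
      odd j = at Q (suc (2 * toℕ j))

      odd≤len : ∀ (j : Fin half) → suc (2 * toℕ j) ≤ len Q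
      odd≤len j = ℕₚ.*-monoʳ-< 2 (Finₚ.toℕ<n j)

      odd∉S : ∀ (j : Fin half) → odd j ∉ S
      odd∉S j = odd⇒∉S Q (odd≤len j) (trans (even-suc (2 * toℕ j)) (cong not (even-2* (toℕ j))))

      odd-injective : ∀ {j j′} → odd j ≡ odd j′ → j ≡ j′
      odd-injective {j} {j′} eq = Finₚ.toℕ-injective (ℕₚ.*-cancelˡ-≡ (toℕ j) (toℕ j′) 2
        (ℕₚ.suc-injective (at-injective Q (odd≤len j) (odd≤len j′) eq)))

      neighbour : Fin half → Fin 3 → Fin n
      neighbour j = proj₁ (neighbours₃ G 3-connected (odd j))

      neighbour-injective : ∀ j {r r′} → neighbour j r ≡ neighbour j r′ → r ≡ r′
      neighbour-injective j = proj₁ (proj₂ (neighbours₃ G 3-connected (odd j)))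

      odd~neighbour : ∀ j r → Adj G (odd j) (neighbour j r)
      odd~neighbour j = proj₂ (proj₂ (neighbours₃ G 3-connected (odd j)))

      slot : Fin n → Fin (suc half)
      slot x = Fin.fromℕ< (s≤s
        (subst (⌊ position x /2⌋ ≤_) (⌊2*/2⌋ half) (ℕₚ.⌊n/2⌋-mono (position≤len x))))

      slot-injective : ∀ {x y} → x ∈ S → y ∈ S → slot x ≡ slot y → x ≡ y
      slot-injective {x} {y} x∈S y∈S eq =
        trans (sym (at-position x)) (trans (cong (at Q) position≡) (at-position y))
        where
        position≡ : position x ≡ position y
        position≡ = ⌊/2⌋-injective
          (∈S⇒even Q (position≤len x) (subst (_∈ S) (sym (at-position x)) x∈S))
          (∈S⇒even Q (position≤len y) (subst (_∈ S) (sym (at-position y)) y∈S))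
          (trans (sym (Finₚ.toℕ-fromℕ< _)) (trans (cong toℕ eq) (Finₚ.toℕ-fromℕ< _)))

      leaf : Fin 3 → Fin n
      leaf zero = a
      leaf (suc zero) = b
      leaf (suc (suc zero)) = c

      Leaf : Fin n → Set
      Leaf x = ∃ λ i → leaf i ≡ x

      not-leaf : ∀ {x} → ¬ Leaf x → ∀ i → x ≢ leaf i
      not-leaf x∉T i x≡ = x∉T (i , sym x≡)

      one-more-I-neighbour : ∀ {s x y} → s ∈ S → x ∉ S → y ∉ S → x ≢ y → ¬ Leaf x → ¬ Leaf y →
                             Adj G s x → Adj G s y → ⊥
      one-more-I-neighbour {s} s∈S x∉S y∉S x≢y x∉T y∉T s~x s~y with s Finₚ.≟ s₀
      ... | yes refl = four-I-neighbours s~a s~b s~c s~x a∉S b∉S c∉S x∉S a≢b a≢c b≢c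
                         (not-leaf x∉T zero) (not-leaf x∉T (suc zero)) (not-leaf x∉T (suc (suc zero)))
      ... | no s≢s₀ with two-of-three claw s∈S s≢s₀
      ...   | inj₁ (s~a , s~b) = four-I-neighbours s~a s~b s~x s~y a∉S b∉S x∉S y∉S a≢b
                                   (not-leaf x∉T zero ∘ sym) (not-leaf x∉T (suc zero) ∘ sym)
                                   (not-leaf y∉T zero) (not-leaf y∉T (suc zero)) (x≢y ∘ sym)
      ...   | inj₂ (inj₁ (s~a , s~c)) = four-I-neighbours s~a s~c s~x s~y a∉S c∉S x∉S y∉S a≢c
                                   (not-leaf x∉T zero ∘ sym) (not-leaf x∉T (suc (suc zero)) ∘ sym)
                                   (not-leaf y∉T zero) (not-leaf y∉T (suc (suc zero))) (x≢y ∘ sym)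
      ...   | inj₂ (inj₂ (s~b , s~c)) = four-I-neighbours s~b s~c s~x s~y b∉S c∉S x∉S y∉S b≢c
                                   (not-leaf x∉T (suc zero) ∘ sym) (not-leaf x∉T (suc (suc zero)) ∘ sym)
                                   (not-leaf y∉T (suc zero)) (not-leaf y∉T (suc (suc zero))) (x≢y ∘ sym)

      neighbour∈S : ∀ j r → neighbour j r ∈ S
      neighbour∈S j r = neighbour-of-∉S (odd∉S j) (odd~neighbour j r)

      leaf? : ∀ x → Dec (Leaf x)
      leaf? x = Finₚ.any? (λ i → leaf i Finₚ.≟ x)

      code : ∀ j (r : Fin 3) → Dec (Leaf (odd j)) → Fin (suc half) ⊎ Fin (3 * 3)
      code j r (yes (i , _)) = inj₂ (Fin.combine i r)
      code j r (no _) = inj₁ (slot (neighbour j r))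

      code-injective : ∀ {j j′ r r′} (d : Dec (Leaf (odd j))) (d′ : Dec (Leaf (odd j′))) →
                       code j r d ≡ code j′ r′ d′ → (j , r) ≡ (j′ , r′)
      code-injective {r = r} {r′} (yes (i , leaf≡)) (yes (i′ , leaf≡′)) eq
        with Finₚ.combine-injective i r i′ r′ (Data.Sum.Properties.inj₂-injective eq)
      ... | refl , refl = cong (_, r) (odd-injective (trans (sym leaf≡) leaf≡′))
      code-injective {j} {j′} {r} {r′} (no j∉T) (no j′∉T) eq
        with slot-injective (neighbour∈S j r) (neighbour∈S j′ r′) (Data.Sum.Properties.inj₁-injective eq)
      ... | same with j Finₚ.≟ j′
      ...   | yes refl = cong (j ,_) (neighbour-injective j same)
      ...   | no j≢j′ = ⊥-elim (one-more-I-neighbour (neighbour∈S j r) (odd∉S j) (odd∉S j′)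
                          (j≢j′ ∘ odd-injective) j∉T j′∉T (Adj-sym G (odd~neighbour j r))
                          (subst (λ s → Adj G s (odd j′)) (sym same) (Adj-sym G (odd~neighbour j′ r′))))

      len≤10 : len Q ≤ 10
      len≤10 = ℕₚ.+-cancelˡ-≤ half (2 * half) 10 (subst₂ _≤_ (ℕₚ.*-comm half 3) (sym (ℕₚ.+-suc half 9))
        (injection⇒≤ Finₚ.*↔× Finₚ.+↔⊎ (λ (j , r) → code j r (leaf? (odd j)))
          λ {(j , r)} {(j′ , r′)} → code-injective (leaf? (odd j)) (leaf? (odd j′))))

    short⇒small : len Q ≤ 10 → ¬ 13 ≤ n
    short⇒small len≤10 13≤n =
      ℕₚ.≤⇒≯ (ℕₚ.≤-trans 13≤n (ℕₚ.≤-trans (n≤len+2 Q off⇒start) (s≤s (s≤s len≤10)))) (ℕₚ.n<1+n 12)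
      where
      off⇒start : ∀ {x} → ¬ x ∈ₜ Q → x ≡ at Q 0
      off⇒start x∉Q = ⊥-elim (x∉Q (spanning _))

    impossible : 13 ≤ n → ⊥
    impossible 13≤n =
      short⇒small (subst (_≤ 10) (sym (proj₁ length-four)) (s≤s (s≤s (s≤s (s≤s z≤n))))) 13≤n
      where
      claw-free : ClawFree Q
      claw-free claw _ _ _ = short⇒small (Counting.len≤10 claw) 13≤n
      open SaturatedPath Q (λ {_} {y} _ _ _ → spanning y) claw-free

  single-path-impossible : 13 ≤ n → ¬ 2 ≤ h → ¬ (∀ x → x ∈ S → ∃ λ l → x ∈ₜ track l)
  single-path-impossible 13≤n h<2 S-covered = Spanning.impossible l spanning 13≤n
    where
    on-track : ∀ x → ∃ λ l → x ∈ₜ track l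
    on-track x with x ∈? S
    ... | yes x∈S = S-covered x x∈S
    ... | no x∉S = I-covered x∉S
    l = proj₁ (on-track (Fin.fromℕ< 13≤n))
    spanning : ∀ x → x ∈ₜ track l
    spanning x = subst (λ k → x ∈ₜ track k) (Fin-irrelevant h<2 _ _) (proj₂ (on-track x))

lemma5p1 : ∀ {n} (G : Graph n) (S : Subset n) (h : ℕ) (P : Fin h → AltPath G S) →
    Connected G → KConnected 3 G → (K14 -Free) G → (K14e -Free) G →
    IsSplitPartition G S → 13 ≤ n → IsICover G S h P →
    ((¬ (∀ x → x ∈ S → ∃[ i ] (path (P i) ∈V) x)) ⊎ 2 ≤ h) ×
    (∀ i → HamPath G (start (path (P i))) (end (path (P i))))
-- The hypothesis Connected G is implied by KConnected 3 G.
lemma5p1 G S h P _ 3-connected K14-free K14e-free split 13≤n cover = two-paths , hamiltonian-paths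
  where
  open Cover P 3-connected K14-free K14e-free split cover
  open Tracks G S using (toTrack-end; ∈V⇔∈ₜ)
  two-paths : (¬ (∀ x → x ∈ S → ∃[ i ] (path (P i) ∈V) x)) ⊎ 2 ≤ h
  two-paths with 2 ℕ.≤? h
  ... | yes 2≤h = inj₂ 2≤h
  ... | no h<2 = inj₁ λ S-covered → single-path-impossible 13≤n h<2 λ x x∈S →
    Data.Product.map₂ (Equivalence.to (∈V⇔∈ₜ (P _))) (S-covered x x∈S)
  hamiltonian-paths : ∀ i → HamPath G (start (path (P i))) (end (path (P i)))
  hamiltonian-paths i = subst (HamPath G _) (sym (toTrack-end (P i))) (Through.hamiltonian-through i 13≤n)
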